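{- Let $w\in S_n$ and $w'\in S_k$, and let $w''\in S_{n+k}$ have one-line notation $w'(1)+n,\dots,w'(k)+n,w(1),\dots,w(n)$. If the Newton polytopes of $\hat{\mathfrak G}_w$ and $\hat{\mathfrak G}_{w'}$ are schubitopes, then so is the Newton polytope of $\hat{\mathfrak G}_{w''}$.
   Context: Grothendieck polynomials: for $w\in S_N$, $\mathfrak G_{w_0}=x_1^{N-1}\cdots x_{N-1}$ for $w_0=N\,(N-1)\cdots1$, and $\mathfrak G_w=\partial_i((1-x_{i+1})\mathfrak G_{ws_i})$ whenever $w(i)<w(i+1)$ ($ws_i$ swaps entries in positions $i,i+1$; $\partial_if=(f-s_if)/(x_i-x_{i+1})$). $\hat{\mathfrak G}_w$ is the highest-degree nonzero homogeneous component of $\mathfrak G_w$. Newton polytope = convex hull of the support (exponent vectors with nonzero coefficient). Schubitopes: for $R,S\subseteq[N]$, $R\le S$ means $|R|=|S|$ and the $k$-th smallest element of $R$ is at most the $k$-th smallest of $S$ for all $k$; for diagrams $C,D\subseteq[N]\times[m]$, $C\le D$ means $C_j\le D_j$ for every column $j$ ($C_j$ = rows of squares of $C$ in column $j$). The schubitope of $D$ is the convex hull of $\{\mathrm{wt}(C):C\le D\}$ ($\mathrm{wt}(C)_i$ = number of squares in row $i$); a polytope is a schubitope if it is the schubitope of some diagram. -}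

module Defs where

open import Data.Nat as ℕ using (ℕ; zero; suc; _∸_; _*_)
open import Data.Nat.Properties using (+-comm)
open import Data.Integer as ℤ using (ℤ; +_; -_)
open import Data.Fin as Fin using (Fin; toℕ; inject₁; splitAt; cast; _↑ˡ_; _↑ʳ_)
open import Data.Fin.Permutation using (Permutation′; _⟨$⟩ʳ_)
open import Data.Vec as Vec using (Vec; lookup; tabulate; _[_]%=_; _[_]≔_)
import Data.Vec.Properties as VecP
open import Data.List as List using (List; []; _∷_; _++_; map; concatMap; filter; allFin; foldr; length; upTo)
open import Data.List.Relation.Unary.All using (All)
open import Data.List.Relation.Binary.Pointwise using (Pointwise)
open import Data.Bool as Bool using (Bool; true; false)
open import Data.Maybe using (Maybe; just; nothing)
open import Data.Sum using (inj₁; inj₂)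
open import Data.Product using (_×_; _,_; proj₁; proj₂; ∃; ∃-syntax; Σ-syntax)
open import Data.Rational as ℚ using (ℚ)
open import Relation.Nullary using (yes; no; ¬_)
open import Relation.Binary.PropositionalEquality using (_≡_; _≢_)

-- Polynomials in N variables x_1..x_N (0-indexed here) with integer
-- coefficients, as formal (unnormalised) sums of terms c · x^e.

Exp : ℕ → Set
Exp N = Vec ℕ N

Poly : ℕ → Set
Poly N = List (ℤ × Exp N)

private
  _≟e_ : ∀ {N} (e f : Exp N) → _
  e ≟e f = VecP.≡-dec ℕ._≟_ e f

coeff : ∀ {N} → Poly N → Exp N → ℤ
coeff [] e = + 0
coeff ((c , f) ∷ p) e with f ≟e e
... | yes _ = c ℤ.+ coeff p e
... | no  _ = coeff p e

negP : ∀ {N} → Poly N → Poly N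
negP = map (λ t → (- proj₁ t , proj₂ t))

mulVar : ∀ {N} → Fin N → Poly N → Poly N
mulVar b = map (λ t → (proj₁ t , proj₂ t [ b ]%= suc))

oneMinusX : ∀ {N} → Fin N → Poly N → Poly N
oneMinusX b p = p ++ negP (mulVar b p)

-- divided difference ∂_i f = (f - s_i f)/(x_i - x_{i+1}), where a = i,
-- b = i+1 (0-based positions).  On a monomial with x_a-exponent p and
-- x_b-exponent q, with lo = min p q, hi = max p q:
--   ∂ (x_a^p x_b^q ·rest) = ± Σ_{j=0}^{hi-lo-1} x_a^(lo+j) x_b^(hi-1-j) ·rest
-- with sign + if p > q and − if p < q (and 0 if p = q).
divDiff : ∀ {N} → Fin N → Fin N → Poly N → Poly N
divDiff {N} a b = concatMap term
  where
  term : ℤ × Exp N → Poly N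
  term (c , e) =
    let p = lookup e a ; q = lookup e b
        lo = ℕ._⊓_ p q ; hi = ℕ._⊔_ p q
        c' = sgn p q c
    in map (λ j → (c' , (e [ a ]≔ (lo ℕ.+ j)) [ b ]≔ (hi ∸ 1 ∸ j))) (upTo (hi ∸ lo))
    where
    sgn : ℕ → ℕ → ℤ → ℤ
    sgn p q c with q ℕ.<? p
    ... | yes _ = c
    ... | no  _ = - c

-- Grothendieck polynomials.  A permutation w ∈ S_N is given in one-line
-- notation as a function Fin N → Fin N (0-based positions and values).

adjPairs : (N : ℕ) → List (Fin N × Fin N)
adjPairs zero = []
adjPairs (suc M) = map (λ i → (inject₁ i , Fin.suc i)) (allFin M)

firstAscent : ∀ {N} → (Fin N → Fin N) → List (Fin N × Fin N) → Maybe (Fin N × Fin N)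
firstAscent w [] = nothing
firstAscent w ((a , b) ∷ ps) with toℕ (w a) ℕ.<? toℕ (w b)
... | yes _ = just (a , b)
... | no  _ = firstAscent w ps

-- w s_i : swap the entries in positions a and b
swapPos : ∀ {N} → Fin N → Fin N → (Fin N → Fin N) → Fin N → Fin N
swapPos a b w x with x Fin.≟ a | x Fin.≟ b
... | yes _ | _     = w b
... | no  _ | yes _ = w a
... | no  _ | no  _ = w x

staircase : ∀ {N} → Poly N
staircase {N} = (+ 1 , tabulate (λ i → N ∸ 1 ∸ toℕ i)) ∷ []

-- 𝔊_w = ∂_i((1 - x_{i+1}) 𝔊_{w s_i}) at the first ascent i; 𝔊_{w0} = x^δ.
-- The fuel bounds the number of steps (each step increases the number of
-- inversions by one, so N*N fuel always suffices for permutations).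
grothFuel : ∀ {N} → ℕ → (Fin N → Fin N) → Poly N
grothFuel zero w = staircase
grothFuel {N} (suc f) w with firstAscent w (adjPairs N)
... | nothing = staircase
... | just (a , b) = divDiff a b (oneMinusX b (grothFuel f (swapPos a b w)))

groth : ∀ {N} → (Fin N → Fin N) → Poly N
groth {N} w = grothFuel (N * N) w

degree : ∀ {N} → Exp N → ℕ
degree = Vec.sum

-- largest degree of a monomial with nonzero coefficient (0 if f = 0)
topDeg : ∀ {N} → Poly N → ℕ
topDeg p = foldr (λ t m → degOf t ℕ.⊔ m) 0 p
  where
  degOf : _ → ℕ
  degOf (c , e) with coeff p e ℤ.≟ + 0
  ... | yes _ = 0
  ... | no  _ = degree e

topComponent : ∀ {N} → Poly N → Poly N
topComponent p = filter (λ t → degree (proj₂ t) ℕ.≟ topDeg p) p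

Point : ℕ → Set
Point N = Vec ℚ N

toPoint : ∀ {N} → Exp N → Point N
toPoint = Vec.map (λ n → (+ n) ℚ./ 1)

combo : ∀ {N} → List (ℚ × Point N) → Point N
combo [] = Vec.replicate _ ℚ.0ℚ
combo ((l , x) ∷ ws) = Vec.zipWith ℚ._+_ (Vec.map (l ℚ.*_) x) (combo ws)

ConvHull : ∀ {N} → (Point N → Set) → Point N → Set
ConvHull S x = ∃[ ws ] (All (λ t → (ℚ.0ℚ ℚ.≤ proj₁ t) × S (proj₂ t)) ws
                        × foldr ℚ._+_ ℚ.0ℚ (map proj₁ ws) ≡ ℚ.1ℚ
                        × combo ws ≡ x)

SamePolytope : ∀ {N} → (Point N → Set) → (Point N → Set) → Set
SamePolytope P Q = ∀ x → (P x → Q x) × (Q x → P x)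

Support : ∀ {N} → Poly N → Point N → Set
Support p x = ∃[ e ] (coeff p e ≢ + 0 × toPoint e ≡ x)

Newton : ∀ {N} → Poly N → Point N → Set
Newton p = ConvHull (Support p)

-- Diagrams and schubitopes.  A diagram D ⊆ [N] × [m] is a Boolean
-- matrix: D i j = true iff square (row i, column j) is in D.

Diagram : ℕ → ℕ → Set
Diagram N m = Fin N → Fin m → Bool

column : ∀ {N m} → Diagram N m → Fin m → List (Fin N)
column D j = filter (λ i → D i j Bool.≟ true) (allFin _)

-- R ≤ S : |R| = |S| and k-th smallest of R ≤ k-th smallest of S
-- (Pointwise forces equal length; both lists are sorted increasingly)
SetLeq : ∀ {N} → List (Fin N) → List (Fin N) → Set
SetLeq R S = Pointwise (λ r s → toℕ r ℕ.≤ toℕ s) R S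

DiagLeq : ∀ {N m} → Diagram N m → Diagram N m → Set
DiagLeq C D = ∀ j → SetLeq (column C j) (column D j)

wt : ∀ {N m} → Diagram N m → Exp N
wt {N} {m} C = tabulate (λ i → length (filter (λ j → C i j Bool.≟ true) (allFin m)))

Schubitope : ∀ {N m} → Diagram N m → Point N → Set
Schubitope {N} {m} D = ConvHull (λ x → ∃[ C ] (DiagLeq {N} {m} C D × toPoint (wt C) ≡ x))

IsSchubitope : ∀ {N} → (Point N → Set) → Set
IsSchubitope {N} P = ∃[ m ] ∃[ D ] SamePolytope P (Schubitope {N} {m} D)

NewtonTopGroth : ∀ {N} → (Fin N → Fin N) → Point N → Set
NewtonTopGroth w = Newton (topComponent (groth w))

-- w'' ∈ S_{n+k} with one-line notation w'(1)+n, …, w'(k)+n, w(1), …, w(n)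

concatPerm : ∀ {n k} → Permutation′ n → Permutation′ k → Fin (n ℕ.+ k) → Fin (n ℕ.+ k)
concatPerm {n} {k} w w' i with splitAt k (cast (+-comm n k) i)
... | inj₁ a = n ↑ʳ (w' ⟨$⟩ʳ a)
... | inj₂ b = (w ⟨$⟩ʳ b) ↑ˡ k

-- Every adjacent ascent of w″ lies among its first k positions (an ascent of w′, shifted by n) or among
-- its last n (an ascent of w), and the former come first.  So the recursion for 𝔊_{w″} runs that of
-- 𝔊_{w′} in x₁,…,x_k and then that of 𝔊_w in x_{k+1},…,x_{n+k}; the staircase monomial factors
-- accordingly and each step commutes with the other factor, whence
--   𝔊_{w″} = (x₁⋯x_k)ⁿ · 𝔊_{w′}(x₁,…,x_k) · 𝔊_w(x_{k+1},…,x_{n+k}).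
-- The top-degree monomials of such a product are the products of top-degree monomials of the factors,
-- so with P′, P the Newton polytopes of 𝔊̂_{w′}, 𝔊̂_w, that of 𝔊̂_{w″} is n·(1,…,1,0,…,0) + P′ × P
-- (convex hulls commute with this operation).  If P′ and P are the schubitopes of D′ and D, this is the
-- schubitope of the diagram glued from D′ on the top k rows and D on the bottom n rows, with the top
-- rows filled above each of the r nonempty columns of D and in n − r extra columns: every diagram below
-- it is glued in the same way from diagrams below D′ and D.  Here r ≤ n, as the top-justified diagram
-- of D has r squares in its first row while the exponents of 𝔊_w are below n.

module Submission where

open import Defs
open import Data.Nat as ℕ using (ℕ; zero; suc; _+_; _*_; _∸_; _≤_; _<_; z≤n; s≤s; _<ᵇ_; _⊔_; _⊓_)
import Data.Nat.Properties as ℕₚ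
open import Data.Integer as ℤ using (ℤ; +_; -_)
import Data.Integer.Properties as ℤₚ
open import Data.Rational as ℚ using (ℚ; 0ℚ; 1ℚ)
import Data.Rational.Properties as ℚₚ
import Data.Rational.Unnormalised as ℚᵘ
import Data.Rational.Unnormalised.Properties as ℚᵘₚ
open import Data.Bool as Bool using (Bool; true; false; if_then_else_)
open import Data.Fin as Fin using (Fin; toℕ; inject₁; splitAt; cast; _↑ˡ_; _↑ʳ_)
import Data.Fin.Properties as Finₚ
open import Data.Fin.Permutation using (Permutation′; _⟨$⟩ʳ_)
import Data.Fin.Permutation as Perm
import Data.Fin.Permutation.Components as PermC
open import Data.Vec as Vec using (Vec; lookup; tabulate; _[_]≔_; _[_]%=_)
import Data.Vec.Properties as Vecₚ
open import Data.Vec.Relation.Binary.Pointwise.Extensional using (ext; Pointwise-≡⇒≡)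
open import Data.List as List using (List; []; _∷_; _++_; map; concatMap; filter; allFin; length; upTo)
import Data.List.Properties as Listₚ
open import Data.List.Relation.Unary.All as All using (All; []; _∷_)
import Data.List.Relation.Unary.All.Properties as Allₚ
open import Data.List.Relation.Unary.Any using (Any; here; there)
open import Data.List.Membership.Propositional using (_∈_)
open import Data.List.Relation.Binary.Pointwise as Pointwise using (Pointwise; []; _∷_)
open import Data.List.Relation.Binary.Permutation.Propositional using (_↭_; prep; swap; ↭-refl; ↭-sym; ↭-trans; ↭-reflexive; module PermutationReasoning)
import Data.List.Relation.Binary.Permutation.Propositional.Properties as ↭ₚ
open import Data.Maybe using (Maybe; just; nothing)
open import Data.Product using (_×_; _,_; proj₁; proj₂; ∃-syntax; Σ-syntax)
open import Data.Sum using (_⊎_; inj₁; inj₂; [_,_]′)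
open import Data.Empty using (⊥-elim)
open import Function using (_∘_; _∋_; case_of_)
open import Relation.Nullary using (Dec; yes; no; ¬_; _×-dec_; does)
open import Relation.Binary.Definitions using (tri<; tri≈; tri>)
open import Relation.Binary.PropositionalEquality
import Data.Nat.Solver as ℕ-Solver
import Data.Rational.Solver as ℚ-Solver
import Algebra.Properties.CommutativeSemigroup as CommutativeSemigroupₚ
import Algebra.Properties.CommutativeMonoid.Sum as CommutativeMonoidSumₚ


concatMap⁺ : ∀ {A B : Set} {f g : A → List B} → (∀ x → f x ↭ g x) →
             ∀ {xs ys} → xs ↭ ys → concatMap f xs ↭ concatMap g ys
concatMap⁺ {f = f} {g} f↭g {xs} _↭_.refl = pointwise xs
  where
  pointwise : ∀ xs → concatMap f xs ↭ concatMap g xs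
  pointwise []       = ↭-refl
  pointwise (x ∷ xs) = ↭ₚ.++⁺ (f↭g x) (pointwise xs)
concatMap⁺ f↭g (prep x p)                 = ↭ₚ.++⁺ (f↭g x) (concatMap⁺ f↭g p)
concatMap⁺ {f = f} f↭g (swap x y p)       =
  ↭-trans (↭ₚ.shifts (f x) (f y)) (↭ₚ.++⁺ (f↭g y) (↭ₚ.++⁺ (f↭g x) (concatMap⁺ f↭g p)))
concatMap⁺ f↭g (_↭_.trans p q)            = ↭-trans (concatMap⁺ (λ _ → ↭-refl) p) (concatMap⁺ f↭g q)

concatMap-++-distrib : ∀ {A B : Set} (f g : A → List B) xs →
  concatMap (λ x → f x ++ g x) xs ↭ concatMap f xs ++ concatMap g xs
concatMap-++-distrib f g []       = ↭-refl
concatMap-++-distrib f g (x ∷ xs) = begin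
  (f x ++ g x) ++ concatMap (λ x → f x ++ g x) xs ≡⟨ Listₚ.++-assoc (f x) (g x) _ ⟩
  f x ++ g x ++ concatMap (λ x → f x ++ g x) xs   ↭⟨ ↭ₚ.++⁺ˡ (f x) (↭ₚ.++⁺ˡ (g x) (concatMap-++-distrib f g xs)) ⟩
  f x ++ g x ++ concatMap f xs ++ concatMap g xs   ↭⟨ ↭ₚ.++⁺ˡ (f x) (↭ₚ.shifts (g x) (concatMap f xs)) ⟩
  f x ++ concatMap f xs ++ g x ++ concatMap g xs   ≡⟨ Listₚ.++-assoc (f x) _ _ ⟨
  (f x ++ concatMap f xs) ++ g x ++ concatMap g xs ∎
  where open PermutationReasoning

concatMap-map-comm : ∀ {A B C : Set} (h : A → B → C) xs ys →
  concatMap (λ y → map (λ x → h x y) xs) ys ↭ concatMap (λ x → map (h x) ys) xs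
concatMap-map-comm h []       ys = nil ys
  where
  nil : ∀ ys → concatMap (λ _ → []) ys ↭ []
  nil []       = ↭-refl
  nil (_ ∷ ys) = nil ys
concatMap-map-comm h (x ∷ xs) ys = ↭-trans (split ys) (↭ₚ.++⁺ˡ (map (h x) ys) (concatMap-map-comm h xs ys))
  where
  split : ∀ ys → concatMap (λ y → h x y ∷ map (λ x′ → h x′ y) xs) ys ↭
                 map (h x) ys ++ concatMap (λ y → map (λ x′ → h x′ y) xs) ys
  split []       = ↭-refl
  split (y ∷ ys) = prep (h x y) (↭-trans (↭ₚ.++⁺ˡ (map (λ x′ → h x′ y) xs) (split ys))
                                         (↭ₚ.shifts (map (λ x′ → h x′ y) xs) (map (h x) ys)))

concatMap-concatMap : ∀ {A B C : Set} (f : B → List C) (g : A → List B) xs →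
  concatMap f (concatMap g xs) ≡ concatMap (concatMap f ∘ g) xs
concatMap-concatMap f g []       = refl
concatMap-concatMap f g (x ∷ xs) = trans (Listₚ.concatMap-++ f (g x) _) (cong (concatMap f (g x) ++_) (concatMap-concatMap f g xs))

filter-map : ∀ {X Y : Set} {P : Y → Set} (P? : ∀ y → Dec (P y)) (f : X → Y) xs →
             filter P? (map f xs) ≡ map f (filter (P? ∘ f) xs)
filter-map P? f []       = refl
filter-map P? f (x ∷ xs) with does (P? (f x))
... | true  = cong (f x ∷_) (filter-map P? f xs)
... | false = filter-map P? f xs

tabulate-cast : ∀ {X : Set} {a b} (eq : a ≡ b) (f : Fin b → X) → List.tabulate f ≡ List.tabulate (f ∘ cast eq)
tabulate-cast {a = zero}  {zero}  eq f = refl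
tabulate-cast {a = suc a} {suc b} eq f = cong (f Fin.zero ∷_) (tabulate-cast (ℕₚ.suc-injective eq) (f ∘ Fin.suc))

tabulate-++ : ∀ {X : Set} a {b} (f : Fin (a + b) → X) →
              List.tabulate f ≡ List.tabulate (f ∘ (_↑ˡ b)) ++ List.tabulate (f ∘ (a ↑ʳ_))
tabulate-++ zero    f = refl
tabulate-++ (suc a) f = cong (f Fin.zero ∷_) (tabulate-++ a (f ∘ Fin.suc))


Vec-map-injective : ∀ {A B : Set} {f : A → B} → (∀ {x y} → f x ≡ f y → x ≡ y) →
                    ∀ {m} {xs ys : Vec A m} → Vec.map f xs ≡ Vec.map f ys → xs ≡ ys
Vec-map-injective f-inj {xs = Vec.[]}     {Vec.[]}     _  = refl
Vec-map-injective f-inj {xs = x Vec.∷ xs} {y Vec.∷ ys} eq =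
  cong₂ Vec._∷_ (f-inj (Vecₚ.∷-injectiveˡ eq)) (Vec-map-injective f-inj (Vecₚ.∷-injectiveʳ eq))

sum-cast : ∀ {a b} .(eq : a ≡ b) (xs : Vec ℕ a) → Vec.sum (Vec.cast eq xs) ≡ Vec.sum xs
sum-cast {b = zero}  eq Vec.[]        = refl
sum-cast {b = suc _} eq (x Vec.∷ xs) = cong (_+_ x) (sum-cast (cong ℕ.pred eq) xs)

sum-map-+ : ∀ c {m} (xs : Vec ℕ m) → Vec.sum (Vec.map (_+_ c) xs) ≡ m * c + Vec.sum xs
sum-map-+ c Vec.[]                 = refl
sum-map-+ c {suc m} (x Vec.∷ xs) = trans (cong (_+_ (c + x)) (sum-map-+ c xs)) (interchange c x (m * c) (Vec.sum xs))
  where open CommutativeSemigroupₚ ℕₚ.+-commutativeSemigroup using (interchange)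


-- Coefficients and top-degree components

-- The decision procedure used by coeff, so that `with` on it unfolds coeff.
_≟ₑ_ : ∀ {N} (e f : Exp N) → Dec (e ≡ f)
_≟ₑ_ = Vecₚ.≡-dec ℕ._≟_

coeff-∷-≡ : ∀ {N} c (e : Exp N) q → coeff ((c , e) ∷ q) e ≡ c ℤ.+ coeff q e
coeff-∷-≡ c e q with e ≟ₑ e
... | yes _  = refl
... | no e≢e = ⊥-elim (e≢e refl)

coeff-∷-≢ : ∀ {N} c {f e : Exp N} q → f ≢ e → coeff ((c , f) ∷ q) e ≡ coeff q e
coeff-∷-≢ c {f} {e} q f≢e with f ≟ₑ e
... | yes f≡e = ⊥-elim (f≢e f≡e)
... | no _    = refl

coeff-∷ : ∀ {N} (t : ℤ × Exp N) q e → coeff (t ∷ q) e ≡ coeff (t ∷ []) e ℤ.+ coeff q e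
coeff-∷ (c , f) q e with f ≟ₑ e
... | yes _ = cong (ℤ._+ coeff q e) (sym (ℤₚ.+-identityʳ c))
... | no _  = sym (ℤₚ.+-identityˡ (coeff q e))

coeff-∷-cong : ∀ {N} (t : ℤ × Exp N) {p q} e → coeff p e ≡ coeff q e → coeff (t ∷ p) e ≡ coeff (t ∷ q) e
coeff-∷-cong (c , f) e eq with f ≟ₑ e
... | yes _ = cong (ℤ._+_ c) eq
... | no _  = eq

coeff-swap : ∀ {N} (s t : ℤ × Exp N) q e → coeff (s ∷ t ∷ q) e ≡ coeff (t ∷ s ∷ q) e
coeff-swap s t q e = begin
  coeff (s ∷ t ∷ q) e                                        ≡⟨ coeff-∷ s _ e ⟩
  coeff (s ∷ []) e ℤ.+ coeff (t ∷ q) e                       ≡⟨ cong (ℤ._+_ (coeff (s ∷ []) e)) (coeff-∷ t q e) ⟩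
  coeff (s ∷ []) e ℤ.+ (coeff (t ∷ []) e ℤ.+ coeff q e)      ≡⟨ x∙yz≈y∙xz (coeff (s ∷ []) e) (coeff (t ∷ []) e) (coeff q e) ⟩
  coeff (t ∷ []) e ℤ.+ (coeff (s ∷ []) e ℤ.+ coeff q e)      ≡⟨ cong (ℤ._+_ (coeff (t ∷ []) e)) (coeff-∷ s q e) ⟨
  coeff (t ∷ []) e ℤ.+ coeff (s ∷ q) e                       ≡⟨ coeff-∷ t _ e ⟨
  coeff (t ∷ s ∷ q) e                                        ∎
  where
  open ≡-Reasoning
  open CommutativeSemigroupₚ ℤₚ.+-commutativeSemigroup using (x∙yz≈y∙xz)

coeff-↭ : ∀ {N} {p q : Poly N} → p ↭ q → ∀ e → coeff p e ≡ coeff q e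
coeff-↭ _↭_.refl         e = refl
coeff-↭ (prep t r)        e = coeff-∷-cong t e (coeff-↭ r e)
coeff-↭ (swap {ys = q} s t r) e = trans (coeff-∷-cong s e (coeff-∷-cong t e (coeff-↭ r e))) (coeff-swap s t q e)
coeff-↭ (_↭_.trans r r′)  e = trans (coeff-↭ r e) (coeff-↭ r′ e)

coeff-++ : ∀ {N} (p q : Poly N) e → coeff (p ++ q) e ≡ coeff p e ℤ.+ coeff q e
coeff-++ []      q e = sym (ℤₚ.+-identityˡ (coeff q e))
coeff-++ (t ∷ p) q e = begin
  coeff (t ∷ p ++ q) e                                ≡⟨ coeff-∷ t (p ++ q) e ⟩
  coeff (t ∷ []) e ℤ.+ coeff (p ++ q) e               ≡⟨ cong (ℤ._+_ (coeff (t ∷ []) e)) (coeff-++ p q e) ⟩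
  coeff (t ∷ []) e ℤ.+ (coeff p e ℤ.+ coeff q e)      ≡⟨ ℤₚ.+-assoc (coeff (t ∷ []) e) _ _ ⟨
  (coeff (t ∷ []) e ℤ.+ coeff p e) ℤ.+ coeff q e      ≡⟨ cong (ℤ._+ coeff q e) (coeff-∷ t p e) ⟨
  coeff (t ∷ p) e ℤ.+ coeff q e                       ∎
  where open ≡-Reasoning

Occurs : ∀ {N} → Exp N → Poly N → Set
Occurs e p = Any (λ t → proj₂ t ≡ e) p

coeff≢0⇒Occurs : ∀ {N} (p : Poly N) e → coeff p e ≢ + 0 → Occurs e p
coeff≢0⇒Occurs []            e nz = ⊥-elim (nz refl)
coeff≢0⇒Occurs ((c , f) ∷ p) e nz with f ≟ₑ e
... | yes f≡e = here f≡e
... | no _    = there (coeff≢0⇒Occurs p e nz)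

module _ {N} {P : Exp N → Set} (P? : ∀ e → Dec (P e)) where

  coeff-filter-accept : ∀ q {e} → P e → coeff (filter (P? ∘ proj₂) q) e ≡ coeff q e
  coeff-filter-accept []            _  = refl
  coeff-filter-accept ((c , f) ∷ q) Pe with P? f
  ... | yes _ = coeff-∷-cong (c , f) _ (coeff-filter-accept q Pe)
  ... | no ¬Pf = trans (coeff-filter-accept q Pe) (sym (coeff-∷-≢ c q (λ f≡e → ¬Pf (subst P (sym f≡e) Pe))))

  coeff-filter-reject : ∀ q {e} → ¬ P e → coeff (filter (P? ∘ proj₂) q) e ≡ + 0
  coeff-filter-reject []            _   = refl
  coeff-filter-reject ((c , f) ∷ q) ¬Pe with P? f
  ... | yes Pf = trans (coeff-∷-≢ c _ (λ f≡e → ¬Pe (subst P f≡e Pf))) (coeff-filter-reject q ¬Pe)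
  ... | no _   = coeff-filter-reject q ¬Pe


foldr-⊔-upper : ∀ {T : Set} (g : T → ℕ) {ts t} → t ∈ ts → g t ≤ List.foldr (λ t m → g t ⊔ m) 0 ts
foldr-⊔-upper g {t ∷ ts} (here refl) = ℕₚ.m≤m⊔n (g t) _
foldr-⊔-upper g {s ∷ ts} (there t∈ts) = ℕₚ.≤-trans (foldr-⊔-upper g t∈ts) (ℕₚ.m≤n⊔m (g s) _)

foldr-⊔-attained : ∀ {T : Set} (g : T → ℕ) ts → let M = List.foldr (λ t m → g t ⊔ m) 0 ts in
                   M ≡ 0 ⊎ ∃[ t ] (t ∈ ts × M ≡ g t)
foldr-⊔-attained g []       = inj₁ refl
foldr-⊔-attained g (s ∷ ts) with ℕₚ.⊔-sel (g s) (List.foldr (λ t m → g t ⊔ m) 0 ts) | foldr-⊔-attained g ts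
... | inj₁ M≡gs | _                     = inj₂ (s , here refl , M≡gs)
... | inj₂ M≡M′ | inj₁ M′≡0             = inj₁ (trans M≡M′ M′≡0)
... | inj₂ M≡M′ | inj₂ (t , t∈ts , M′≡gt) = inj₂ (t , there t∈ts , trans M≡M′ M′≡gt)

Occurs⇒∈ : ∀ {N} {e} {p : Poly N} → Occurs e p → ∃[ c ] ((c , e) ∈ p)
Occurs⇒∈ (here refl)     = _ , here refl
Occurs⇒∈ (there e∈p) with Occurs⇒∈ e∈p
... | c , ce∈p = c , there ce∈p

-- The degree function summed by topDeg is local to Defs; abstracting coeff p e ℤ.≟ + 0 unfolds it.
degree≤topDeg : ∀ {N} (p : Poly N) {e} → coeff p e ≢ + 0 → degree e ≤ topDeg p
degree≤topDeg p {e} nz with Occurs⇒∈ (coeff≢0⇒Occurs p e nz)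
... | c , ce∈p with (_ ≤ topDeg p) ∋ foldr-⊔-upper _ ce∈p
...   | le with coeff p e ℤ.≟ + 0
...     | yes z = ⊥-elim (nz z)
...     | no _  = le

topDeg-attained : ∀ {N} (p : Poly N) → topDeg p ≡ 0 ⊎ ∃[ e ] (coeff p e ≢ + 0 × topDeg p ≡ degree e)
topDeg-attained p with (topDeg p ≡ 0 ⊎ ∃[ t ] (t ∈ p × topDeg p ≡ _)) ∋ foldr-⊔-attained _ p
... | inj₁ top≡0 = inj₁ top≡0
... | inj₂ ((c , e) , _ , top≡) with coeff p e ℤ.≟ + 0
...   | yes _ = inj₁ top≡
...   | no nz = inj₂ (e , nz , top≡)

TopMonomial : ∀ {N} → Poly N → Exp N → Set
TopMonomial p e = coeff p e ≢ + 0 × (∀ f → coeff p f ≢ + 0 → degree f ≤ degree e)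

TopMonomial-↭ : ∀ {N} {p q : Poly N} → p ↭ q → ∀ {e} → TopMonomial p e → TopMonomial q e
TopMonomial-↭ p↭q {e} (nz , top) =
  (λ z → nz (trans (coeff-↭ p↭q e) z)) , (λ f nzf → top f (λ z → nzf (trans (sym (coeff-↭ p↭q f)) z)))

topComponent⇒TopMonomial : ∀ {N} (p : Poly N) {e} → coeff (topComponent p) e ≢ + 0 → TopMonomial p e
topComponent⇒TopMonomial p {e} nz with degree e ℕ.≟ topDeg p
... | no deg≢top  = ⊥-elim (nz (coeff-filter-reject (λ f → degree f ℕ.≟ topDeg p) p deg≢top))
... | yes deg≡top = (λ z → nz (trans (coeff-filter-accept (λ f → degree f ℕ.≟ topDeg p) p deg≡top) z))
                  , (λ f nzf → ℕₚ.≤-trans (degree≤topDeg p nzf) (ℕₚ.≤-reflexive (sym deg≡top)))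

TopMonomial⇒topComponent : ∀ {N} (p : Poly N) {e} → TopMonomial p e → coeff (topComponent p) e ≢ + 0
TopMonomial⇒topComponent p {e} (nz , top) z =
  nz (trans (sym (coeff-filter-accept (λ f → degree f ℕ.≟ topDeg p) p deg≡top)) z)
  where
  deg≡top : degree e ≡ topDeg p
  deg≡top with topDeg-attained p
  ... | inj₁ top≡0 = ℕₚ.≤-antisym (degree≤topDeg p nz) (ℕₚ.≤-trans (ℕₚ.≤-reflexive top≡0) z≤n)
  ... | inj₂ (f , nzf , top≡f) = ℕₚ.≤-antisym (degree≤topDeg p nz) (ℕₚ.≤-trans (ℕₚ.≤-reflexive top≡f) (top f nzf))


-- The recursion defining Grothendieck polynomials

Adjacent : ∀ {N} → Fin N → Fin N → Set
Adjacent a b = toℕ b ≡ suc (toℕ a)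

Ascent : ∀ {N} → (Fin N → Fin N) → Fin N → Fin N → Set
Ascent w a b = toℕ (w a) < toℕ (w b)

NoAscent : ∀ {N} → (Fin N → Fin N) → Set
NoAscent w = ∀ a b → Adjacent a b → ¬ Ascent w a b

IsFirstAscent : ∀ {N} → (Fin N → Fin N) → Fin N → Fin N → Set
IsFirstAscent w a b = Adjacent a b × Ascent w a b × (∀ a′ b′ → Adjacent a′ b′ → toℕ a′ < toℕ a → ¬ Ascent w a′ b′)

firstAscentOf : ∀ {N} → (Fin N → Fin N) → Maybe (Fin N × Fin N)
firstAscentOf {N} w = firstAscent w (adjPairs N)

Adjacent⇒≢ : ∀ {N} {a b : Fin N} → Adjacent a b → a ≢ b
Adjacent⇒≢ {a = a} ab refl = ℕₚ.<-irrefl ab (ℕₚ.n<1+n (toℕ a))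

private
  pathPairs : ∀ {N} M → (Fin (suc M) → Fin N) → List (Fin N × Fin N)
  pathPairs M e = List.tabulate (λ i → e (inject₁ i) , e (Fin.suc i))

  pathPairs-nothing : ∀ {N} M (e : Fin (suc M) → Fin N) w → firstAscent w (pathPairs M e) ≡ nothing →
                      ∀ i → ¬ Ascent w (e (inject₁ i)) (e (Fin.suc i))
  pathPairs-nothing (suc M) e w eq i with toℕ (w (e Fin.zero)) ℕ.<? toℕ (w (e (Fin.suc Fin.zero)))
  pathPairs-nothing (suc M) e w () i           | yes _
  pathPairs-nothing (suc M) e w eq Fin.zero    | no ¬asc = ¬asc
  pathPairs-nothing (suc M) e w eq (Fin.suc i) | no _    = pathPairs-nothing M (e ∘ Fin.suc) w eq i

  pathPairs-just : ∀ {N} M (e : Fin (suc M) → Fin N) w p → firstAscent w (pathPairs M e) ≡ just p →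
    Σ[ i ∈ Fin M ] (p ≡ (e (inject₁ i) , e (Fin.suc i)) × Ascent w (e (inject₁ i)) (e (Fin.suc i))
                    × (∀ j → toℕ j < toℕ i → ¬ Ascent w (e (inject₁ j)) (e (Fin.suc j))))
  pathPairs-just zero    e w p ()
  pathPairs-just (suc M) e w p eq with toℕ (w (e Fin.zero)) ℕ.<? toℕ (w (e (Fin.suc Fin.zero)))
  pathPairs-just (suc M) e w p refl | yes asc = Fin.zero , refl , asc , λ _ ()
  ... | no ¬asc with pathPairs-just M (e ∘ Fin.suc) w p eq
  ...   | i , p≡ , asc , first = Fin.suc i , p≡ , asc , first′
    where
    first′ : ∀ j → toℕ j < suc (toℕ i) → ¬ Ascent w (e (inject₁ j)) (e (Fin.suc j))
    first′ Fin.zero    _         = ¬asc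
    first′ (Fin.suc j) (s≤s j<i) = first j j<i

  adjPairs≡pathPairs : ∀ M → adjPairs (suc M) ≡ pathPairs M (λ i → i)
  adjPairs≡pathPairs M = Listₚ.map-tabulate (λ i → i) (λ i → inject₁ i , Fin.suc i)

  Adjacent-view : ∀ {M} {a b : Fin (suc M)} → Adjacent a b →
                  Σ[ i ∈ Fin M ] (inject₁ i ≡ a × Fin.suc i ≡ b × toℕ i ≡ toℕ a)
  Adjacent-view {M} {a} {b} ab = i , Finₚ.toℕ-injective (trans (Finₚ.toℕ-inject₁ i) i≡a)
                               , Finₚ.toℕ-injective (trans (cong suc i≡a) (sym ab)) , i≡a
    where
    a<M : toℕ a < M
    a<M = subst (_≤ M) ab (ℕₚ.≤-pred (Finₚ.toℕ<n b))
    i = Fin.fromℕ< a<M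
    i≡a : toℕ i ≡ toℕ a
    i≡a = Finₚ.toℕ-fromℕ< a<M

≡nothing⇒NoAscent : ∀ {N} (w : Fin N → Fin N) → firstAscentOf w ≡ nothing → NoAscent w
≡nothing⇒NoAscent {suc M} w eq a b ab with Adjacent-view ab
... | i , refl , refl , _ = pathPairs-nothing M (λ i → i) w (trans (cong (firstAscent w) (sym (adjPairs≡pathPairs M))) eq) i

≡just⇒IsFirstAscent : ∀ {N} (w : Fin N → Fin N) {a b} → firstAscentOf w ≡ just (a , b) → IsFirstAscent w a b
≡just⇒IsFirstAscent {suc M} w eq
  with pathPairs-just M (λ i → i) w _ (trans (cong (firstAscent w) (sym (adjPairs≡pathPairs M))) eq)
... | i , refl , asc , first = cong suc (sym (Finₚ.toℕ-inject₁ i)) , asc , first′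
  where
  first′ : ∀ a′ b′ → Adjacent a′ b′ → toℕ a′ < toℕ (inject₁ i) → ¬ Ascent w a′ b′
  first′ a′ b′ ab′ a′<i with Adjacent-view ab′
  ... | j , refl , refl , j≡a′ = first j (subst₂ _<_ (sym j≡a′) (Finₚ.toℕ-inject₁ i) a′<i)

NoAscent⇒≡nothing : ∀ {N} (w : Fin N → Fin N) → NoAscent w → firstAscentOf w ≡ nothing
NoAscent⇒≡nothing w none with firstAscentOf w in eq
... | nothing = refl
... | just (a , b) with ≡just⇒IsFirstAscent w eq
...   | ab , asc , _ = ⊥-elim (none a b ab asc)

IsFirstAscent⇒≡just : ∀ {N} (w : Fin N → Fin N) {a b} → IsFirstAscent w a b → firstAscentOf w ≡ just (a , b)
IsFirstAscent⇒≡just w {a} {b} (ab , asc , first) with firstAscentOf w in eq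
... | nothing = ⊥-elim (≡nothing⇒NoAscent w eq a b ab asc)
... | just (a′ , b′) with ≡just⇒IsFirstAscent w eq
...   | ab′ , asc′ , first′ with ℕₚ.<-cmp (toℕ a) (toℕ a′)
...     | tri< a<a′ _ _ = ⊥-elim (first′ a b ab a<a′ asc)
...     | tri> _ _ a′<a = ⊥-elim (first a′ b′ ab′ a′<a asc′)
...     | tri≈ _ a≡a′ _ = cong just (cong₂ _,_ (Finₚ.toℕ-injective (sym a≡a′))
                                              (Finₚ.toℕ-injective (trans ab′ (trans (cong suc (sym a≡a′)) (sym ab)))))


transpose-≡ˡ : ∀ {N} (i j : Fin N) → PermC.transpose i j i ≡ j
transpose-≡ˡ i j with i Fin.≟ i
... | yes _  = refl
... | no i≢i = ⊥-elim (i≢i refl)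

transpose-≡ʳ : ∀ {N} (i j : Fin N) → PermC.transpose i j j ≡ i
transpose-≡ʳ i j with j Fin.≟ i
... | yes j≡i = j≡i
... | no _ with j Fin.≟ j
...   | yes _  = refl
...   | no j≢j = ⊥-elim (j≢j refl)

data TransposeView {N} (a b x : Fin N) : Fin N → Set where
  at-a  : x ≡ a → TransposeView a b x b
  at-b  : x ≡ b → TransposeView a b x a
  other : x ≢ a → x ≢ b → TransposeView a b x x

transpose-view : ∀ {N} (a b x : Fin N) → TransposeView a b x (PermC.transpose a b x)
transpose-view a b x with x Fin.≟ a
... | yes x≡a = at-a x≡a
... | no x≢a with x Fin.≟ b
...   | yes x≡b = at-b x≡b
...   | no x≢b  = other x≢a x≢b

transpose-fixes : ∀ {N} {a b x : Fin N} → x ≢ a → x ≢ b → PermC.transpose a b x ≡ x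
transpose-fixes {a = a} {b} {x} x≢a x≢b with PermC.transpose a b x | transpose-view a b x
... | _ | at-a x≡a  = ⊥-elim (x≢a x≡a)
... | _ | at-b x≡b  = ⊥-elim (x≢b x≡b)
... | _ | other _ _ = refl

transpose-map : ∀ {M N} (f : Fin M → Fin N) → (∀ {x y} → f x ≡ f y → x ≡ y) →
                ∀ a b c → PermC.transpose (f a) (f b) (f c) ≡ f (PermC.transpose a b c)
transpose-map f f-inj a b c with PermC.transpose a b c | transpose-view a b c
... | _ | at-a refl       = transpose-≡ˡ (f c) (f b)
... | _ | at-b refl       = transpose-≡ʳ (f a) (f c)
... | _ | other c≢a c≢b   = transpose-fixes (c≢a ∘ f-inj) (c≢b ∘ f-inj)

swapPos≗transpose : ∀ {N} a b (w : Fin N → Fin N) x → swapPos a b w x ≡ w (PermC.transpose a b x)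
swapPos≗transpose a b w x with x Fin.≟ a
... | yes _ = refl
... | no _ with x Fin.≟ b
...   | yes _ = refl
...   | no _  = refl


data Halts {N} : ℕ → (Fin N → Fin N) → Set where
  done : ∀ {f w} → firstAscentOf w ≡ nothing → Halts f w
  step : ∀ {f w a b} → firstAscentOf w ≡ just (a , b) → Halts f (swapPos a b w) → Halts (suc f) w

grothFuel-done : ∀ {N} f (w : Fin N → Fin N) → firstAscentOf w ≡ nothing → grothFuel f w ≡ staircase
grothFuel-done zero    w _ = refl
grothFuel-done (suc f) w eq with firstAscentOf w
grothFuel-done (suc f) w refl | nothing = refl

grothFuel-step : ∀ {N} f (w : Fin N → Fin N) {a b} → firstAscentOf w ≡ just (a , b) →
                 grothFuel (suc f) w ≡ divDiff a b (oneMinusX b (grothFuel f (swapPos a b w)))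
grothFuel-step f w eq with firstAscentOf w
grothFuel-step f w refl | just _ = refl

grothFuel-stable : ∀ {N} {f} {w : Fin N → Fin N} → Halts f w → ∀ {g} → f ≤ g → grothFuel g w ≡ grothFuel f w
grothFuel-stable {f = f} {w} (done eq) {g} _ = trans (grothFuel-done g w eq) (sym (grothFuel-done f w eq))
grothFuel-stable {f = suc f} {w} (step {a = a} {b} eq h) {suc g} (s≤s f≤g) = begin
  grothFuel (suc g) w                                        ≡⟨ grothFuel-step g w eq ⟩
  divDiff a b (oneMinusX b (grothFuel g (swapPos a b w)))    ≡⟨ cong (divDiff a b ∘ oneMinusX b) (grothFuel-stable h f≤g) ⟩
  divDiff a b (oneMinusX b (grothFuel f (swapPos a b w)))    ≡⟨ grothFuel-step f w eq ⟨
  grothFuel (suc f) w                                        ∎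
  where open ≡-Reasoning

Halts-mono : ∀ {N} {f} {w : Fin N → Fin N} → Halts f w → ∀ {g} → f ≤ g → Halts g w
Halts-mono (done eq)   _         = done eq
Halts-mono (step eq h) (s≤s f≤g) = step eq (Halts-mono h f≤g)

firstAscent-cong : ∀ {N} {w v : Fin N → Fin N} → (∀ x → w x ≡ v x) → ∀ ps → firstAscent w ps ≡ firstAscent v ps
firstAscent-cong w≗v [] = refl
firstAscent-cong {w = w} {v} w≗v ((a , b) ∷ ps) with toℕ (w a) ℕ.<? toℕ (w b) | toℕ (v a) ℕ.<? toℕ (v b)
... | yes _    | yes _    = refl
... | no _     | no _     = firstAscent-cong w≗v ps
... | yes asc  | no ¬asc  = ⊥-elim (¬asc (subst₂ (λ x y → toℕ x < toℕ y) (w≗v a) (w≗v b) asc))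
... | no ¬asc  | yes asc  = ⊥-elim (¬asc (subst₂ (λ x y → toℕ x < toℕ y) (sym (w≗v a)) (sym (w≗v b)) asc))

swapPos-cong : ∀ {N} a b {w v : Fin N → Fin N} → (∀ x → w x ≡ v x) → ∀ x → swapPos a b w x ≡ swapPos a b v x
swapPos-cong a b {w} {v} w≗v x =
  trans (swapPos≗transpose a b w x) (trans (w≗v _) (sym (swapPos≗transpose a b v x)))

grothFuel-cong : ∀ {N} f {w v : Fin N → Fin N} → (∀ x → w x ≡ v x) → grothFuel f w ≡ grothFuel f v
grothFuel-cong zero    w≗v = refl
grothFuel-cong {N} (suc f) {w} {v} w≗v with firstAscentOf w | firstAscentOf v | firstAscent-cong w≗v (adjPairs N)
... | nothing      | .nothing           | refl = refl
... | just (a , b) | .(just (a , b))    | refl = cong (divDiff a b ∘ oneMinusX b) (grothFuel-cong f (swapPos-cong a b w≗v))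


-- Termination of the recursion

module Σ = CommutativeMonoidSumₚ ℕₚ.+-0-commutativeMonoid

sum-mono-≤ : ∀ {N} {f g : Fin N → ℕ} → (∀ i → f i ≤ g i) → Σ.sum f ≤ Σ.sum g
sum-mono-≤ {zero}  f≤g = z≤n
sum-mono-≤ {suc N} f≤g = ℕₚ.+-mono-≤ (f≤g Fin.zero) (sum-mono-≤ (f≤g ∘ Fin.suc))

sum-mono-< : ∀ {N} {f g : Fin N → ℕ} → (∀ i → f i ≤ g i) → ∀ i₀ → f i₀ < g i₀ → Σ.sum f < Σ.sum g
sum-mono-< f≤g Fin.zero     lt = ℕₚ.+-mono-<-≤ lt (sum-mono-≤ (f≤g ∘ Fin.suc))
sum-mono-< f≤g (Fin.suc i₀) lt = ℕₚ.+-mono-≤-< (f≤g Fin.zero) (sum-mono-< (f≤g ∘ Fin.suc) i₀ lt)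

sum≤* : ∀ {N} (f : Fin N → ℕ) c → (∀ i → f i ≤ c) → Σ.sum f ≤ N * c
sum≤* {zero}  f c f≤c = z≤n
sum≤* {suc N} f c f≤c = ℕₚ.+-mono-≤ (f≤c Fin.zero) (sum≤* (f ∘ Fin.suc) c (f≤c ∘ Fin.suc))

indicator : ∀ {P : Set} → Dec P → ℕ
indicator (yes _) = 1
indicator (no _)  = 0

indicator-mono : ∀ {P Q : Set} (P? : Dec P) (Q? : Dec Q) → (P → Q) → indicator P? ≤ indicator Q?
indicator-mono (yes p) (yes _) _   = ℕₚ.≤-refl
indicator-mono (yes p) (no ¬q) p⇒q = ⊥-elim (¬q (p⇒q p))
indicator-mono (no _)  _       _   = z≤n

indicator-< : ∀ {P Q : Set} (P? : Dec P) (Q? : Dec Q) → ¬ P → Q → indicator P? < indicator Q?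
indicator-< (yes p) _       ¬p _ = ⊥-elim (¬p p)
indicator-< (no _)  (yes _) _  _ = ℕₚ.≤-refl
indicator-< (no _)  (no ¬q) _  q = ⊥-elim (¬q q)

indicator≤1 : ∀ {P : Set} (P? : Dec P) → indicator P? ≤ 1
indicator≤1 (yes _) = ℕₚ.≤-refl
indicator≤1 (no _)  = z≤n

module _ {N} {a b : Fin N} (ab : Adjacent a b) where

  private
    a<b : toℕ a < toℕ b
    a<b = ℕₚ.≤-reflexive (sym ab)

    ≢⇒toℕ≢ : ∀ {x y : Fin N} → x ≢ y → toℕ x ≢ toℕ y
    ≢⇒toℕ≢ x≢y = x≢y ∘ Finₚ.toℕ-injective

  transpose-adjacent-reflects-< : ∀ {i j} → toℕ (PermC.transpose b a i) < toℕ (PermC.transpose b a j) →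
                                  toℕ i < toℕ j ⊎ (i ≡ b × j ≡ a)
  transpose-adjacent-reflects-< {i} {j} lt
    with PermC.transpose b a i | transpose-view b a i | PermC.transpose b a j | transpose-view b a j
  ... | _ | at-a refl   | _ | at-a refl   = ⊥-elim (ℕₚ.<-irrefl refl lt)
  ... | _ | at-a refl   | _ | at-b refl   = inj₂ (refl , refl)
  ... | _ | at-a refl   | _ | other j≢b _ = inj₁ (ℕₚ.≤∧≢⇒< (subst (_≤ toℕ j) (sym ab) lt) (≢⇒toℕ≢ j≢b ∘ sym))
  ... | _ | at-b refl   | _ | at-a refl   = ⊥-elim (ℕₚ.<-asym a<b lt)
  ... | _ | at-b refl   | _ | at-b refl   = ⊥-elim (ℕₚ.<-irrefl refl lt)
  ... | _ | at-b refl   | _ | other _ _   = inj₁ (ℕₚ.<-trans a<b lt)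
  ... | _ | other _ _   | _ | at-a refl   = inj₁ (ℕₚ.<-trans lt a<b)
  ... | _ | other _ i≢a | _ | at-b refl   = inj₁ (ℕₚ.≤∧≢⇒< (ℕₚ.≤-pred (subst (toℕ i <_) ab lt)) (≢⇒toℕ≢ i≢a))
  ... | _ | other _ _   | _ | other _ _   = inj₁ lt

bothLess : ∀ {N} (i j x y : Fin N) → ℕ
bothLess i j x y = indicator ((toℕ i ℕ.<? toℕ j) ×-dec (toℕ x ℕ.<? toℕ y))

-- Swapping an adjacent ascent removes a non-inversion, so this measure bounds the recursion by N * N steps.
nonInversions : ∀ {N} → (Fin N → Fin N) → ℕ
nonInversions w = Σ.sum λ i → Σ.sum λ j → bothLess i j (w i) (w j)

nonInversions≤N*N : ∀ {N} (w : Fin N → Fin N) → nonInversions w ≤ N * N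
nonInversions≤N*N {N} w = sum≤* (λ i → Σ.sum λ j → bothLess i j (w i) (w j)) N λ i →
  ℕₚ.≤-trans (sum≤* (λ j → bothLess i j (w i) (w j)) 1 (λ j → indicator≤1 _)) (ℕₚ.≤-reflexive (ℕₚ.*-identityʳ N))

module _ {N} {a b : Fin N} (ab : Adjacent a b) (w : Fin N → Fin N) (asc : Ascent w a b) where

  private
    T T′ : Fin N → Fin N
    T  = PermC.transpose a b
    T′ = PermC.transpose b a

    reindexed : nonInversions (swapPos a b w) ≡ Σ.sum λ i → Σ.sum λ j → bothLess (T′ i) (T′ j) (w i) (w j)
    reindexed = begin
      nonInversions (swapPos a b w)
        ≡⟨ Σ.sum-cong-≗ (λ i → Σ.sum-cong-≗ λ j → cong₂ (bothLess i j) (swapPos≗transpose a b w i) (swapPos≗transpose a b w j)) ⟩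
      (Σ.sum λ i → Σ.sum λ j → bothLess i j (w (T i)) (w (T j)))
        ≡⟨ Σ.sum-permute _ (Perm.transpose b a) ⟩
      (Σ.sum λ i → Σ.sum λ j → bothLess (T′ i) j (w (T (T′ i))) (w (T j)))
        ≡⟨ Σ.sum-cong-≗ (λ i → Σ.sum-permute (λ j → bothLess (T′ i) j (w (T (T′ i))) (w (T j))) (Perm.transpose b a)) ⟩
      (Σ.sum λ i → Σ.sum λ j → bothLess (T′ i) (T′ j) (w (T (T′ i))) (w (T (T′ j))))
        ≡⟨ Σ.sum-cong-≗ (λ i → Σ.sum-cong-≗ λ j → cong₂ (bothLess (T′ i) (T′ j))
                          (cong w (PermC.transpose-inverse a b)) (cong w (PermC.transpose-inverse a b))) ⟩
      (Σ.sum λ i → Σ.sum λ j → bothLess (T′ i) (T′ j) (w i) (w j)) ∎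
      where open ≡-Reasoning

    termwise : ∀ i j → bothLess (T′ i) (T′ j) (w i) (w j) ≤ bothLess i j (w i) (w j)
    termwise i j = indicator-mono _ _ λ (lt , wlt) → case (transpose-adjacent-reflects-< ab lt) wlt
      where
      case : toℕ i < toℕ j ⊎ (i ≡ b × j ≡ a) → Ascent w i j → toℕ i < toℕ j × Ascent w i j
      case (inj₁ i<j)          wlt = i<j , wlt
      case (inj₂ (refl , refl)) wlt = ⊥-elim (ℕₚ.<-asym asc wlt)

    strict : bothLess (T′ a) (T′ b) (w a) (w b) < bothLess a b (w a) (w b)
    strict rewrite transpose-≡ˡ b a | transpose-≡ʳ b a =
      indicator-< _ _ (λ (b<a , _) → ℕₚ.<-asym b<a (ℕₚ.≤-reflexive (sym ab))) (ℕₚ.≤-reflexive (sym ab) , asc)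

  nonInversions-swap-< : nonInversions (swapPos a b w) < nonInversions w
  nonInversions-swap-< = subst (_< nonInversions w) (sym reindexed)
    (sum-mono-< (λ i → sum-mono-≤ (termwise i)) a (sum-mono-< (termwise a) b strict))

nonInversions≤⇒Halts : ∀ {N} f (w : Fin N → Fin N) → nonInversions w ≤ f → Halts f w
nonInversions≤⇒Halts f w le with firstAscentOf w in eq
... | nothing = done eq
... | just (a , b) with ≡just⇒IsFirstAscent w eq
...   | ab , asc , _ with f | nonInversions-swap-< ab w asc
...     | zero   | lt = ⊥-elim (ℕₚ.<⇒≱ lt (ℕₚ.≤-trans le z≤n))
...     | suc f′ | lt = step eq (nonInversions≤⇒Halts f′ (swapPos a b w) (ℕₚ.≤-pred (ℕₚ.≤-trans lt le)))

groth-Halts : ∀ {N} (w : Fin N → Fin N) → Halts (N * N) w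
groth-Halts w = nonInversions≤⇒Halts _ w (nonInversions≤N*N w)


-- Exponents of Grothendieck polynomials

sign : ℕ → ℕ → ℤ → ℤ
sign p q c with q ℕ.<? p
... | yes _ = c
... | no _  = - c

-- The summand of divDiff, which Defs keeps local to its where block.
divDiffTerm : ∀ {N} → Fin N → Fin N → ℤ × Exp N → Poly N
divDiffTerm a b (c , e) =
  map (λ j → sign (lookup e a) (lookup e b) c ,
             (e [ a ]≔ (lookup e a ⊓ lookup e b + j)) [ b ]≔ (lookup e a ⊔ lookup e b ∸ 1 ∸ j))
      (upTo (lookup e a ⊔ lookup e b ∸ lookup e a ⊓ lookup e b))

divDiff≡concatMap : ∀ {N} (a b : Fin N) p → divDiff a b p ≡ concatMap (divDiffTerm a b) p
divDiff≡concatMap a b []            = refl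
divDiff≡concatMap a b ((c , e) ∷ p) with lookup e b ℕ.<? lookup e a
... | yes _ = cong (_ ++_) (divDiff≡concatMap a b p)
... | no _  = cong (_ ++_) (divDiff≡concatMap a b p)

divDiff-↭ : ∀ {N} (a b : Fin N) {p q} → p ↭ q → divDiff a b p ↭ divDiff a b q
divDiff-↭ a b {p} {q} p↭q = subst₂ _↭_ (sym (divDiff≡concatMap a b p)) (sym (divDiff≡concatMap a b q))
                                  (concatMap⁺ (λ _ → ↭-refl) p↭q)

oneMinusX-↭ : ∀ {N} (b : Fin N) {p q} → p ↭ q → oneMinusX b p ↭ oneMinusX b q
oneMinusX-↭ b p↭q = ↭ₚ.++⁺ p↭q (↭ₚ.map⁺ _ (↭ₚ.map⁺ _ p↭q))


ExponentsBounded : ∀ {N} → ℕ → Poly N → Set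
ExponentsBounded B = All (λ t → ∀ i → lookup (proj₂ t) i ≤ B)

ExponentsBoundedExcept : ∀ {N} → Fin N → ℕ → Poly N → Set
ExponentsBoundedExcept b B = All (λ t → (∀ i → i ≢ b → lookup (proj₂ t) i ≤ B) × lookup (proj₂ t) b ≤ suc B)

staircase-bounded : ∀ N → ExponentsBounded (N ∸ 1) (staircase {N})
staircase-bounded N = (λ i → subst (_≤ N ∸ 1) (sym (Vecₚ.lookup∘tabulate _ i)) (ℕₚ.m∸n≤m (N ∸ 1) (toℕ i))) ∷ []

oneMinusX-bounded : ∀ {N B} (b : Fin N) {p} → ExponentsBounded B p → ExponentsBoundedExcept b B (oneMinusX b p)
oneMinusX-bounded {B = B} b {p} bnd =
  Allₚ.++⁺ (All.map (λ e≤ → (λ i _ → e≤ i) , ℕₚ.m≤n⇒m≤1+n (e≤ b)) bnd) (shifted p bnd)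
  where
  shifted : ∀ p → ExponentsBounded B p → ExponentsBoundedExcept b B (negP (mulVar b p))
  shifted []            []         = []
  shifted ((c , e) ∷ p) (e≤ ∷ bnd) =
    ( (λ i i≢b → subst (_≤ B) (sym (Vecₚ.lookup∘updateAt′ i b i≢b e)) (e≤ i))
    , subst (_≤ suc B) (sym (Vecₚ.lookup∘updateAt b e)) (s≤s (e≤ b))) ∷ shifted p bnd

divDiff-bounded : ∀ {N B} {a b : Fin N} → a ≢ b → ∀ {q} → ExponentsBoundedExcept b B q → ExponentsBounded B (divDiff a b q)
divDiff-bounded {B = B} {a} {b} a≢b {q} bnd =
  subst (ExponentsBounded B) (sym (divDiff≡concatMap a b q)) (Allₚ.concat⁺ (Allₚ.map⁺ (All.map term bnd)))
  where
  term : ∀ {t} → (∀ i → i ≢ b → lookup (proj₂ t) i ≤ B) × lookup (proj₂ t) b ≤ suc B →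
         ExponentsBounded B (divDiffTerm a b t)
  term {c , e} (e≤ , eb≤) = Allₚ.map⁺ (Allₚ.applyUpTo⁺₁ _ _ entry)
    where
    P = lookup e a
    Q = lookup e b
    P⊔Q≤ : P ⊔ Q ≤ suc B
    P⊔Q≤ = ℕₚ.⊔-lub (ℕₚ.m≤n⇒m≤1+n (e≤ a a≢b)) eb≤
    entry : ∀ {j} → j < P ⊔ Q ∸ P ⊓ Q → ∀ i → lookup ((e [ a ]≔ (P ⊓ Q + j)) [ b ]≔ (P ⊔ Q ∸ 1 ∸ j)) i ≤ B
    entry {j} j< i with i Fin.≟ b
    ... | yes refl = subst (_≤ B) (sym (Vecₚ.lookup∘update i (e [ a ]≔ (P ⊓ Q + j)) _))
                       (ℕₚ.≤-trans (ℕₚ.m∸n≤m (P ⊔ Q ∸ 1) j) (ℕₚ.∸-monoˡ-≤ 1 P⊔Q≤))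
    ... | no i≢b with i Fin.≟ a
    ...   | yes refl = subst (_≤ B) (sym (trans (Vecₚ.lookup∘update′ i≢b (e [ i ]≔ (P ⊓ Q + j)) _) (Vecₚ.lookup∘update i e _)))
                         (ℕₚ.≤-pred (begin-strict
                           P ⊓ Q + j               <⟨ ℕₚ.+-monoʳ-< (P ⊓ Q) j< ⟩
                           P ⊓ Q + (P ⊔ Q ∸ P ⊓ Q) ≡⟨ ℕₚ.m+[n∸m]≡n (ℕₚ.m⊓n≤m⊔n P Q) ⟩
                           P ⊔ Q                   ≤⟨ P⊔Q≤ ⟩
                           suc B                   ∎))
      where open ℕₚ.≤-Reasoning
    ...   | no i≢a = subst (_≤ B) (sym (trans (Vecₚ.lookup∘update′ i≢b (e [ a ]≔ (P ⊓ Q + j)) _) (Vecₚ.lookup∘update′ i≢a e _)))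
                       (e≤ i i≢b)

grothFuel-bounded : ∀ {N} f (w : Fin N → Fin N) → ExponentsBounded (N ∸ 1) (grothFuel f w)
grothFuel-bounded {N} zero    w = staircase-bounded N
grothFuel-bounded {N} (suc f) w with firstAscentOf w in eq
... | nothing      = staircase-bounded N
... | just (a , b) = divDiff-bounded (Adjacent⇒≢ (proj₁ (≡just⇒IsFirstAscent w eq)))
                                     (oneMinusX-bounded b (grothFuel-bounded f (swapPos a b w)))

topComponent-bounded : ∀ {N B} (p : Poly N) → ExponentsBounded B p →
                       ∀ {e} → coeff (topComponent p) e ≢ + 0 → ∀ i → lookup e i ≤ B
topComponent-bounded {B = B} p bnd {e} nz =
  All.lookupWith (λ t≤ t≡e → subst (λ f → ∀ i → lookup f i ≤ B) t≡e t≤)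
                 (Allₚ.filter⁺ (λ t → degree (proj₂ t) ℕ.≟ topDeg p) bnd)
                 (coeff≢0⇒Occurs (topComponent p) e nz)

module Blocks (n k : ℕ) where

  -- Positions L a = a (the first k, carrying w′) and R b = k + b (the last n, carrying w) of Fin (n + k).

  L : Fin k → Fin (n + k)
  L a = cast (ℕₚ.+-comm k n) (a ↑ˡ n)

  R : Fin n → Fin (n + k)
  R b = cast (ℕₚ.+-comm k n) (k ↑ʳ b)

  toℕ-L : ∀ a → toℕ (L a) ≡ toℕ a
  toℕ-L a = trans (Finₚ.toℕ-cast _ (a ↑ˡ n)) (Finₚ.toℕ-↑ˡ a n)

  toℕ-R : ∀ b → toℕ (R b) ≡ k + toℕ b
  toℕ-R b = trans (Finₚ.toℕ-cast _ (k ↑ʳ b)) (Finₚ.toℕ-↑ʳ k b)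

  block : Fin (n + k) → Fin k ⊎ Fin n
  block i = splitAt k (cast (ℕₚ.+-comm n k) i)

  block-L : ∀ a → block (L a) ≡ inj₁ a
  block-L a = trans (cong (splitAt k) (Finₚ.cast-involutive (ℕₚ.+-comm n k) (ℕₚ.+-comm k n) (a ↑ˡ n))) (Finₚ.splitAt-↑ˡ k a n)

  block-R : ∀ b → block (R b) ≡ inj₂ b
  block-R b = trans (cong (splitAt k) (Finₚ.cast-involutive (ℕₚ.+-comm n k) (ℕₚ.+-comm k n) (k ↑ʳ b))) (Finₚ.splitAt-↑ʳ k n b)

  data BlockView : Fin (n + k) → Set where
    inL : ∀ a → BlockView (L a)
    inR : ∀ b → BlockView (R b)

  blockView : ∀ i → BlockView i
  blockView i with block i in eq
  ... | inj₁ a = subst BlockView (trans (cong (cast (ℕₚ.+-comm k n)) (Finₚ.splitAt⁻¹-↑ˡ eq)) (Finₚ.cast-involutive (ℕₚ.+-comm k n) (ℕₚ.+-comm n k) i)) (inL a)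
  ... | inj₂ b = subst BlockView (trans (cong (cast (ℕₚ.+-comm k n)) (Finₚ.splitAt⁻¹-↑ʳ eq)) (Finₚ.cast-involutive (ℕₚ.+-comm k n) (ℕₚ.+-comm n k) i)) (inR b)

  L-injective : ∀ {a a′} → L a ≡ L a′ → a ≡ a′
  L-injective {a} {a′} eq = Finₚ.toℕ-injective (trans (sym (toℕ-L a)) (trans (cong toℕ eq) (toℕ-L a′)))

  R-injective : ∀ {b b′} → R b ≡ R b′ → b ≡ b′
  R-injective {b} {b′} eq = Finₚ.toℕ-injective (ℕₚ.+-cancelˡ-≡ k _ _ (trans (sym (toℕ-R b)) (trans (cong toℕ eq) (toℕ-R b′))))

  L≢R : ∀ {a b} → L a ≢ R b
  L≢R {a} {b} eq = ℕₚ.<⇒≱ (Finₚ.toℕ<n a)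
    (subst (k ≤_) (trans (sym (toℕ-R b)) (trans (cong toℕ (sym eq)) (toℕ-L a))) (ℕₚ.m≤m+n k (toℕ b)))

  ≡-byBlocks : ∀ {A : Set} {u v : Vec A (n + k)} →
               (∀ a → lookup u (L a) ≡ lookup v (L a)) → (∀ b → lookup u (R b) ≡ lookup v (R b)) → u ≡ v
  ≡-byBlocks onL onR = Pointwise-≡⇒≡ (ext λ i → byView (blockView i))
    where
    byView : ∀ {i} → BlockView i → _
    byView (inL a) = onL a
    byView (inR b) = onR b

  join : ∀ {A : Set} → Vec A k → Vec A n → Vec A (n + k)
  join x y = Vec.cast (ℕₚ.+-comm k n) (x Vec.++ y)

  lookup-join-L : ∀ {A : Set} (x : Vec A k) (y : Vec A n) a → lookup (join x y) (L a) ≡ lookup x a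
  lookup-join-L x y a = trans (Vecₚ.lookup-cast (ℕₚ.+-comm k n) (x Vec.++ y) (a ↑ˡ n)) (Vecₚ.lookup-++ˡ x y a)

  lookup-join-R : ∀ {A : Set} (x : Vec A k) (y : Vec A n) b → lookup (join x y) (R b) ≡ lookup y b
  lookup-join-R x y b = trans (Vecₚ.lookup-cast (ℕₚ.+-comm k n) (x Vec.++ y) (k ↑ʳ b)) (Vecₚ.lookup-++ʳ x y b)

  join-injective : ∀ {A : Set} {x x′ : Vec A k} {y y′ : Vec A n} → join x y ≡ join x′ y′ → x ≡ x′ × y ≡ y′
  join-injective {x = x} {x′} {y} {y′} eq =
      Pointwise-≡⇒≡ (ext λ a → trans (sym (lookup-join-L x y a)) (trans (cong (λ z → lookup z (L a)) eq) (lookup-join-L x′ y′ a)))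
    , Pointwise-≡⇒≡ (ext λ b → trans (sym (lookup-join-R x y b)) (trans (cong (λ z → lookup z (R b)) eq) (lookup-join-R x′ y′ b)))

  module _ {A : Set} (x : Vec A k) (y : Vec A n) (g : A → A) where

    join-updateAt-L : ∀ a → join x y [ L a ]%= g ≡ join (x [ a ]%= g) y
    join-updateAt-L a = ≡-byBlocks onL onR
      where
      onL : ∀ c → lookup (join x y [ L a ]%= g) (L c) ≡ lookup (join (x [ a ]%= g) y) (L c)
      onL c with c Fin.≟ a
      ... | yes refl = begin
        lookup (join x y [ L c ]%= g) (L c)    ≡⟨ Vecₚ.lookup∘updateAt (L c) (join x y) ⟩
        g (lookup (join x y) (L c))            ≡⟨ cong g (lookup-join-L x y c) ⟩
        g (lookup x c)                         ≡⟨ Vecₚ.lookup∘updateAt c x ⟨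
        lookup (x [ c ]%= g) c                 ≡⟨ lookup-join-L (x [ c ]%= g) y c ⟨
        lookup (join (x [ c ]%= g) y) (L c)    ∎
        where open ≡-Reasoning
      ... | no c≢a = begin
        lookup (join x y [ L a ]%= g) (L c)    ≡⟨ Vecₚ.lookup∘updateAt′ (L c) (L a) (c≢a ∘ L-injective) (join x y) ⟩
        lookup (join x y) (L c)                ≡⟨ lookup-join-L x y c ⟩
        lookup x c                             ≡⟨ Vecₚ.lookup∘updateAt′ c a c≢a x ⟨
        lookup (x [ a ]%= g) c                 ≡⟨ lookup-join-L (x [ a ]%= g) y c ⟨
        lookup (join (x [ a ]%= g) y) (L c)    ∎
        where open ≡-Reasoning
      onR : ∀ b → lookup (join x y [ L a ]%= g) (R b) ≡ lookup (join (x [ a ]%= g) y) (R b)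
      onR b = trans (Vecₚ.lookup∘updateAt′ (R b) (L a) (L≢R ∘ sym) (join x y))
                    (trans (lookup-join-R x y b) (sym (lookup-join-R (x [ a ]%= g) y b)))

    join-updateAt-R : ∀ b → join x y [ R b ]%= g ≡ join x (y [ b ]%= g)
    join-updateAt-R b = ≡-byBlocks onL onR
      where
      onL : ∀ a → lookup (join x y [ R b ]%= g) (L a) ≡ lookup (join x (y [ b ]%= g)) (L a)
      onL a = trans (Vecₚ.lookup∘updateAt′ (L a) (R b) L≢R (join x y))
                    (trans (lookup-join-L x y a) (sym (lookup-join-L x (y [ b ]%= g) a)))
      onR : ∀ c → lookup (join x y [ R b ]%= g) (R c) ≡ lookup (join x (y [ b ]%= g)) (R c)
      onR c with c Fin.≟ b
      ... | yes refl = begin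
        lookup (join x y [ R c ]%= g) (R c)    ≡⟨ Vecₚ.lookup∘updateAt (R c) (join x y) ⟩
        g (lookup (join x y) (R c))            ≡⟨ cong g (lookup-join-R x y c) ⟩
        g (lookup y c)                         ≡⟨ Vecₚ.lookup∘updateAt c y ⟨
        lookup (y [ c ]%= g) c                 ≡⟨ lookup-join-R x (y [ c ]%= g) c ⟨
        lookup (join x (y [ c ]%= g)) (R c)    ∎
        where open ≡-Reasoning
      ... | no c≢b = begin
        lookup (join x y [ R b ]%= g) (R c)    ≡⟨ Vecₚ.lookup∘updateAt′ (R c) (R b) (c≢b ∘ R-injective) (join x y) ⟩
        lookup (join x y) (R c)                ≡⟨ lookup-join-R x y c ⟩
        lookup y c                             ≡⟨ Vecₚ.lookup∘updateAt′ c b c≢b y ⟨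
        lookup (y [ b ]%= g) c                 ≡⟨ lookup-join-R x (y [ b ]%= g) c ⟨
        lookup (join x (y [ b ]%= g)) (R c)    ∎
        where open ≡-Reasoning

module Product (n k : ℕ) where

  open Blocks n k

  shift : Exp k → Exp k
  shift = Vec.map (_+_ n)

  lookup-shift : ∀ x a → lookup (shift x) a ≡ n + lookup x a
  lookup-shift x a = Vecₚ.lookup-map a (_+_ n) x

  _⊗_ : ℤ × Exp k → ℤ × Exp n → ℤ × Exp (n + k)
  (c , x) ⊗ (d , y) = (c ℤ.* d , join (shift x) y)

  -- shiftedProduct A B = (x₁⋯x_k)ⁿ · A(x₁,…,x_k) · B(x_{k+1},…,x_{n+k}).
  shiftedProduct : Poly k → Poly n → Poly (n + k)
  shiftedProduct A B = concatMap (λ t → map (t ⊗_) B) A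

  negMulVar : ∀ {N} → Fin N → ℤ × Exp N → ℤ × Exp N
  negMulVar b (c , e) = (- c , e [ b ]%= suc)

  negP∘mulVar : ∀ {N} (b : Fin N) p → negP (mulVar b p) ≡ map (negMulVar b) p
  negP∘mulVar b p = sym (Listₚ.map-∘ p)

  negMulVar-L : ∀ b t s → negMulVar (L b) (t ⊗ s) ≡ negMulVar b t ⊗ s
  negMulVar-L b (c , x) (d , y) = cong₂ _,_ (ℤₚ.neg-distribˡ-* c d)
    (trans (join-updateAt-L (shift x) y suc b) (cong (λ z → join z y) (sym (Vecₚ.map-updateAt x b (ℕₚ.+-suc n _)))))

  negMulVar-R : ∀ b t s → negMulVar (R b) (t ⊗ s) ≡ t ⊗ negMulVar b s
  negMulVar-R b (c , x) (d , y) = cong₂ _,_ (ℤₚ.neg-distribʳ-* c d) (join-updateAt-R (shift x) y suc b)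

  map-negMulVar-L : ∀ b A B → map (negMulVar (L b)) (shiftedProduct A B) ≡ shiftedProduct (map (negMulVar b) A) B
  map-negMulVar-L b A B = begin
    map (negMulVar (L b)) (shiftedProduct A B)                  ≡⟨ Listₚ.map-concatMap _ _ A ⟩
    concatMap (λ t → map (negMulVar (L b)) (map (t ⊗_) B)) A    ≡⟨ Listₚ.concatMap-cong (λ t → sym (Listₚ.map-∘ B)) A ⟩
    concatMap (λ t → map (λ s → negMulVar (L b) (t ⊗ s)) B) A   ≡⟨ Listₚ.concatMap-cong (λ t → Listₚ.map-cong (negMulVar-L b t) B) A ⟩
    concatMap (λ t → map (negMulVar b t ⊗_) B) A                ≡⟨ Listₚ.concatMap-map _ _ A ⟨
    shiftedProduct (map (negMulVar b) A) B                      ∎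
    where open ≡-Reasoning

  map-negMulVar-R : ∀ b A B → map (negMulVar (R b)) (shiftedProduct A B) ≡ concatMap (λ t → map (t ⊗_) (map (negMulVar b) B)) A
  map-negMulVar-R b A B = begin
    map (negMulVar (R b)) (shiftedProduct A B)                  ≡⟨ Listₚ.map-concatMap _ _ A ⟩
    concatMap (λ t → map (negMulVar (R b)) (map (t ⊗_) B)) A    ≡⟨ Listₚ.concatMap-cong (λ t → sym (Listₚ.map-∘ B)) A ⟩
    concatMap (λ t → map (λ s → negMulVar (R b) (t ⊗ s)) B) A   ≡⟨ Listₚ.concatMap-cong (λ t → Listₚ.map-cong (negMulVar-R b t) B) A ⟩
    concatMap (λ t → map (λ s → t ⊗ negMulVar b s) B) A         ≡⟨ Listₚ.concatMap-cong (λ t → Listₚ.map-∘ B) A ⟩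
    concatMap (λ t → map (t ⊗_) (map (negMulVar b) B)) A        ∎
    where open ≡-Reasoning

  oneMinusX-L : ∀ b A B → oneMinusX (L b) (shiftedProduct A B) ≡ shiftedProduct (oneMinusX b A) B
  oneMinusX-L b A B = begin
    shiftedProduct A B ++ negP (mulVar (L b) (shiftedProduct A B))   ≡⟨ cong (shiftedProduct A B ++_) (negP∘mulVar (L b) _) ⟩
    shiftedProduct A B ++ map (negMulVar (L b)) (shiftedProduct A B) ≡⟨ cong (shiftedProduct A B ++_) (map-negMulVar-L b A B) ⟩
    shiftedProduct A B ++ shiftedProduct (map (negMulVar b) A) B     ≡⟨ Listₚ.concatMap-++ (λ t → map (t ⊗_) B) A _ ⟨
    shiftedProduct (A ++ map (negMulVar b) A) B                      ≡⟨ cong (λ z → shiftedProduct (A ++ z) B) (negP∘mulVar b A) ⟨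
    shiftedProduct (oneMinusX b A) B                                 ∎
    where open ≡-Reasoning

  oneMinusX-R : ∀ b A B → oneMinusX (R b) (shiftedProduct A B) ↭ shiftedProduct A (oneMinusX b B)
  oneMinusX-R b A B = begin
    shiftedProduct A B ++ negP (mulVar (R b) (shiftedProduct A B))
      ≡⟨ cong (shiftedProduct A B ++_) (trans (negP∘mulVar (R b) _) (map-negMulVar-R b A B)) ⟩
    shiftedProduct A B ++ concatMap (λ t → map (t ⊗_) (map (negMulVar b) B)) A
      ↭⟨ concatMap-++-distrib (λ t → map (t ⊗_) B) (λ t → map (t ⊗_) (map (negMulVar b) B)) A ⟨
    concatMap (λ t → map (t ⊗_) B ++ map (t ⊗_) (map (negMulVar b) B)) A
      ≡⟨ Listₚ.concatMap-cong (λ t → Listₚ.map-++ (t ⊗_) B _) A ⟨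
    shiftedProduct A (B ++ map (negMulVar b) B)
      ≡⟨ cong (shiftedProduct A ∘ (B ++_)) (negP∘mulVar b B) ⟨
    shiftedProduct A (oneMinusX b B) ∎
    where open PermutationReasoning

  sign-*ˡ : ∀ p q c d → sign p q (c ℤ.* d) ≡ c ℤ.* sign p q d
  sign-*ˡ p q c d with q ℕ.<? p
  ... | yes _ = refl
  ... | no _  = ℤₚ.neg-distribʳ-* c d

  sign-+-*ʳ : ∀ p q c d → sign (n + p) (n + q) (c ℤ.* d) ≡ sign p q c ℤ.* d
  sign-+-*ʳ p q c d with n + q ℕ.<? n + p | q ℕ.<? p
  ... | yes _   | yes _   = refl
  ... | no _    | no _    = ℤₚ.neg-distribˡ-* c d
  ... | yes q<p | no q≮p  = ⊥-elim (q≮p (ℕₚ.+-cancelˡ-< n q p q<p))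
  ... | no q≮p  | yes q<p = ⊥-elim (q≮p (ℕₚ.+-monoʳ-< n q<p))

  divDiffTerm-R : ∀ a b t s → divDiffTerm (R a) (R b) (t ⊗ s) ≡ map (t ⊗_) (divDiffTerm a b s)
  divDiffTerm-R a b (c , x) (d , y) rewrite lookup-join-R (shift x) y a | lookup-join-R (shift x) y b =
    sym (trans (sym (Listₚ.map-∘ _)) (Listₚ.map-cong (λ j → cong₂ _,_ (sym (sign-*ˡ (lookup y a) (lookup y b) c d)) (updates j)) _))
    where
    updates : ∀ j → let u = lookup y a ⊓ lookup y b + j ; v = lookup y a ⊔ lookup y b ∸ 1 ∸ j in
              join (shift x) ((y [ a ]≔ u) [ b ]≔ v) ≡ (join (shift x) y [ R a ]≔ u) [ R b ]≔ v
    updates j = sym (trans (cong (_[ R b ]≔ _) (join-updateAt-R (shift x) y _ a)) (join-updateAt-R (shift x) _ _ b))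

  divDiff-R : ∀ a b A B → divDiff (R a) (R b) (shiftedProduct A B) ≡ shiftedProduct A (divDiff a b B)
  divDiff-R a b A B = begin
    divDiff (R a) (R b) (shiftedProduct A B)
      ≡⟨ divDiff≡concatMap (R a) (R b) (shiftedProduct A B) ⟩
    concatMap (divDiffTerm (R a) (R b)) (shiftedProduct A B)
      ≡⟨ concatMap-concatMap _ _ A ⟩
    concatMap (λ t → concatMap (divDiffTerm (R a) (R b)) (map (t ⊗_) B)) A
      ≡⟨ Listₚ.concatMap-cong (λ t → Listₚ.concatMap-map _ _ B) A ⟩
    concatMap (λ t → concatMap (λ s → divDiffTerm (R a) (R b) (t ⊗ s)) B) A
      ≡⟨ Listₚ.concatMap-cong (λ t → Listₚ.concatMap-cong (divDiffTerm-R a b t) B) A ⟩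
    concatMap (λ t → concatMap (map (t ⊗_) ∘ divDiffTerm a b) B) A
      ≡⟨ Listₚ.concatMap-cong (λ t → Listₚ.map-concatMap (t ⊗_) (divDiffTerm a b) B) A ⟨
    concatMap (λ t → map (t ⊗_) (concatMap (divDiffTerm a b) B)) A
      ≡⟨ cong (shiftedProduct A) (divDiff≡concatMap a b B) ⟨
    shiftedProduct A (divDiff a b B) ∎
    where open ≡-Reasoning

  +-∸1∸-assoc : ∀ m {h j} → j < h → m + h ∸ 1 ∸ j ≡ m + (h ∸ 1 ∸ j)
  +-∸1∸-assoc m {suc h} {j} (s≤s j≤h) = trans (cong (λ z → z ∸ 1 ∸ j) (ℕₚ.+-suc m h)) (ℕₚ.+-∸-assoc m j≤h)

  shift-update : ∀ x a v → shift (x [ a ]≔ v) ≡ shift x [ a ]≔ (n + v)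
  shift-update x a v = Vecₚ.map-[]≔ (_+_ n) x a

  divDiffTerm-L : ∀ a b t s → divDiffTerm (L a) (L b) (t ⊗ s) ≡ map (_⊗ s) (divDiffTerm a b t)
  divDiffTerm-L a b (c , x) (d , y)
    rewrite lookup-join-L (shift x) y a | lookup-join-L (shift x) y b | lookup-shift x a | lookup-shift x b
          | sym (ℕₚ.+-distribˡ-⊓ n (lookup x a) (lookup x b)) | sym (ℕₚ.+-distribˡ-⊔ n (lookup x a) (lookup x b))
          | ℕₚ.[m+n]∸[m+o]≡n∸o n (lookup x a ⊔ lookup x b) (lookup x a ⊓ lookup x b)
    = trans (Listₚ.map-cong-local (Allₚ.applyUpTo⁺₁ _ _ λ j< → cong₂ _,_ (sign-+-*ʳ P Q c d) (updates j<))) (Listₚ.map-∘ _)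
    where
    P = lookup x a
    Q = lookup x b
    updates : ∀ {j} → j < P ⊔ Q ∸ P ⊓ Q →
              (join (shift x) y [ L a ]≔ (n + P ⊓ Q + j)) [ L b ]≔ (n + (P ⊔ Q) ∸ 1 ∸ j)
              ≡ join (shift ((x [ a ]≔ (P ⊓ Q + j)) [ b ]≔ (P ⊔ Q ∸ 1 ∸ j))) y
    updates {j} j< = begin
      (join (shift x) y [ L a ]≔ (n + P ⊓ Q + j)) [ L b ]≔ (n + (P ⊔ Q) ∸ 1 ∸ j)
        ≡⟨ cong (_[ L b ]≔ (n + (P ⊔ Q) ∸ 1 ∸ j)) (join-updateAt-L (shift x) y _ a) ⟩
      join (shift x [ a ]≔ (n + P ⊓ Q + j)) y [ L b ]≔ (n + (P ⊔ Q) ∸ 1 ∸ j)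
        ≡⟨ join-updateAt-L _ y _ b ⟩
      join ((shift x [ a ]≔ (n + P ⊓ Q + j)) [ b ]≔ (n + (P ⊔ Q) ∸ 1 ∸ j)) y
        ≡⟨ cong₂ (λ u v → join ((shift x [ a ]≔ u) [ b ]≔ v) y)
                 (ℕₚ.+-assoc n (P ⊓ Q) j) (+-∸1∸-assoc n (ℕₚ.<-≤-trans j< (ℕₚ.m∸n≤m (P ⊔ Q) (P ⊓ Q)))) ⟩
      join ((shift x [ a ]≔ (n + (P ⊓ Q + j))) [ b ]≔ (n + (P ⊔ Q ∸ 1 ∸ j))) y
        ≡⟨ cong (λ z → join (z [ b ]≔ (n + (P ⊔ Q ∸ 1 ∸ j))) y) (shift-update x a _) ⟨
      join (shift (x [ a ]≔ (P ⊓ Q + j)) [ b ]≔ (n + (P ⊔ Q ∸ 1 ∸ j))) y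
        ≡⟨ cong (λ z → join z y) (shift-update _ b _) ⟨
      join (shift ((x [ a ]≔ (P ⊓ Q + j)) [ b ]≔ (P ⊔ Q ∸ 1 ∸ j))) y ∎
      where open ≡-Reasoning

  divDiff-L : ∀ a b A B → divDiff (L a) (L b) (shiftedProduct A B) ↭ shiftedProduct (divDiff a b A) B
  divDiff-L a b A B = begin
    divDiff (L a) (L b) (shiftedProduct A B)
      ≡⟨ divDiff≡concatMap (L a) (L b) (shiftedProduct A B) ⟩
    concatMap (divDiffTerm (L a) (L b)) (shiftedProduct A B)
      ≡⟨ concatMap-concatMap _ _ A ⟩
    concatMap (λ t → concatMap (divDiffTerm (L a) (L b)) (map (t ⊗_) B)) A
      ≡⟨ Listₚ.concatMap-cong (λ t → Listₚ.concatMap-map _ _ B) A ⟩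
    concatMap (λ t → concatMap (λ s → divDiffTerm (L a) (L b) (t ⊗ s)) B) A
      ≡⟨ Listₚ.concatMap-cong (λ t → Listₚ.concatMap-cong (divDiffTerm-L a b t) B) A ⟩
    concatMap (λ t → concatMap (λ s → map (_⊗ s) (divDiffTerm a b t)) B) A
      ↭⟨ concatMap⁺ (λ t → concatMap-map-comm _⊗_ (divDiffTerm a b t) B) (↭-refl {x = A}) ⟩
    concatMap (λ t → concatMap (λ t′ → map (t′ ⊗_) B) (divDiffTerm a b t)) A
      ≡⟨ concatMap-concatMap _ _ A ⟨
    shiftedProduct (concatMap (divDiffTerm a b) A) B
      ≡⟨ cong (λ z → shiftedProduct z B) (divDiff≡concatMap a b A) ⟨
    shiftedProduct (divDiff a b A) B ∎
    where open PermutationReasoning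

  staircase-shiftedProduct : staircase {n + k} ≡ shiftedProduct staircase staircase
  staircase-shiftedProduct = cong (λ e → (+ 1 , e) ∷ []) (≡-byBlocks onL onR)
    where
    δ : ∀ N → Exp N
    δ N = tabulate (λ i → N ∸ 1 ∸ toℕ i)
    onL : ∀ a → lookup (δ (n + k)) (L a) ≡ lookup (join (shift (δ k)) (δ n)) (L a)
    onL a = begin
      lookup (δ (n + k)) (L a)                   ≡⟨ Vecₚ.lookup∘tabulate _ (L a) ⟩
      n + k ∸ 1 ∸ toℕ (L a)                      ≡⟨ cong (λ z → n + k ∸ 1 ∸ z) (toℕ-L a) ⟩
      n + k ∸ 1 ∸ toℕ a                          ≡⟨ +-∸1∸-assoc n (Finₚ.toℕ<n a) ⟩
      n + (k ∸ 1 ∸ toℕ a)                        ≡⟨ cong (_+_ n) (Vecₚ.lookup∘tabulate _ a) ⟨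
      n + lookup (δ k) a                         ≡⟨ lookup-shift (δ k) a ⟨
      lookup (shift (δ k)) a                     ≡⟨ lookup-join-L (shift (δ k)) (δ n) a ⟨
      lookup (join (shift (δ k)) (δ n)) (L a)    ∎
      where open ≡-Reasoning
    onR : ∀ b → lookup (δ (n + k)) (R b) ≡ lookup (join (shift (δ k)) (δ n)) (R b)
    onR b = begin
      lookup (δ (n + k)) (R b)                   ≡⟨ Vecₚ.lookup∘tabulate _ (R b) ⟩
      n + k ∸ 1 ∸ toℕ (R b)                      ≡⟨ cong (λ z → n + k ∸ 1 ∸ z) (toℕ-R b) ⟩
      n + k ∸ 1 ∸ (k + toℕ b)                    ≡⟨ ℕₚ.∸-+-assoc (n + k) 1 (k + toℕ b) ⟩
      n + k ∸ (1 + (k + toℕ b))                  ≡⟨ cong₂ _∸_ (ℕₚ.+-comm n k) (sym (ℕₚ.+-suc k (toℕ b))) ⟩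
      k + n ∸ (k + suc (toℕ b))                  ≡⟨ ℕₚ.[m+n]∸[m+o]≡n∸o k n (suc (toℕ b)) ⟩
      n ∸ suc (toℕ b)                            ≡⟨ ℕₚ.∸-+-assoc n 1 (toℕ b) ⟨
      n ∸ 1 ∸ toℕ b                              ≡⟨ Vecₚ.lookup∘tabulate _ b ⟨
      lookup (δ n) b                             ≡⟨ lookup-join-R (shift (δ k)) (δ n) b ⟨
      lookup (join (shift (δ k)) (δ n)) (R b)    ∎
      where open ≡-Reasoning

module Concatenation (n k : ℕ) where

  open Blocks n k
  open Product n k

  concatFun : (Fin n → Fin n) → (Fin k → Fin k) → Fin (n + k) → Fin (n + k)
  concatFun u v i = [ (λ a → n ↑ʳ v a) , (λ b → u b ↑ˡ k) ]′ (block i)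

  concatPerm≗concatFun : (w : Permutation′ n) (w′ : Permutation′ k) → ∀ i → concatPerm w w′ i ≡ concatFun (w ⟨$⟩ʳ_) (w′ ⟨$⟩ʳ_) i
  concatPerm≗concatFun w w′ i with splitAt k (cast (ℕₚ.+-comm n k) i)
  ... | inj₁ _ = refl
  ... | inj₂ _ = refl

  concatFun-L : ∀ u v a → concatFun u v (L a) ≡ n ↑ʳ v a
  concatFun-L u v a = cong [ (λ a → n ↑ʳ v a) , (λ b → u b ↑ˡ k) ]′ (block-L a)

  concatFun-R : ∀ u v b → concatFun u v (R b) ≡ u b ↑ˡ k
  concatFun-R u v b = cong [ (λ a → n ↑ʳ v a) , (λ b → u b ↑ˡ k) ]′ (block-R b)

  module _ (u : Fin n → Fin n) (v : Fin k → Fin k) where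

    toℕ-concatFun-L : ∀ a → toℕ (concatFun u v (L a)) ≡ n + toℕ (v a)
    toℕ-concatFun-L a = trans (cong toℕ (concatFun-L u v a)) (Finₚ.toℕ-↑ʳ n (v a))

    toℕ-concatFun-R : ∀ b → toℕ (concatFun u v (R b)) ≡ toℕ (u b)
    toℕ-concatFun-R b = trans (cong toℕ (concatFun-R u v b)) (Finₚ.toℕ-↑ˡ (u b) k)

    Adjacent-L : ∀ {a b} → Adjacent a b → Adjacent (L a) (L b)
    Adjacent-L {a} {b} ab = trans (toℕ-L b) (trans ab (cong suc (sym (toℕ-L a))))

    Adjacent-R : ∀ {a b} → Adjacent a b → Adjacent (R a) (R b)
    Adjacent-R {a} {b} ab = trans (toℕ-R b) (trans (cong (_+_ k) ab) (trans (ℕₚ.+-suc k _) (cong suc (sym (toℕ-R a)))))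

    Ascent-L : ∀ {a b} → Ascent v a b → Ascent (concatFun u v) (L a) (L b)
    Ascent-L {a} {b} asc = subst₂ _<_ (sym (toℕ-concatFun-L a)) (sym (toℕ-concatFun-L b)) (ℕₚ.+-monoʳ-< n asc)

    Ascent-R : ∀ {a b} → Ascent u a b → Ascent (concatFun u v) (R a) (R b)
    Ascent-R {a} {b} asc = subst₂ _<_ (sym (toℕ-concatFun-R a)) (sym (toℕ-concatFun-R b)) asc

    data AscentView : Fin (n + k) → Fin (n + k) → Set where
      inL : ∀ {a b} → Adjacent a b → Ascent v a b → AscentView (L a) (L b)
      inR : ∀ {a b} → Adjacent a b → Ascent u a b → AscentView (R a) (R b)

    ascentView : ∀ {x y} → Adjacent x y → Ascent (concatFun u v) x y → AscentView x y
    ascentView {x} {y} xy asc with blockView x | blockView y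
    ... | inL a | inL b = inL (trans (sym (toℕ-L b)) (trans xy (cong suc (toℕ-L a))))
                              (ℕₚ.+-cancelˡ-< n _ _ (subst₂ _<_ (toℕ-concatFun-L a) (toℕ-concatFun-L b) asc))
    ... | inL a | inR b = ⊥-elim (ℕₚ.<⇒≱ (subst₂ _<_ (toℕ-concatFun-L a) (toℕ-concatFun-R b) asc)
                                          (ℕₚ.≤-trans (ℕₚ.<⇒≤ (Finₚ.toℕ<n (u b))) (ℕₚ.m≤m+n n _)))
    ... | inR a | inL b = ⊥-elim (ℕₚ.<⇒≱ (Finₚ.toℕ<n b)
                            (subst (k ≤_) (trans (sym (trans xy (cong suc (toℕ-R a)))) (toℕ-L b)) (ℕₚ.≤-trans (ℕₚ.m≤m+n k _) (ℕₚ.n≤1+n _))))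
    ... | inR a | inR b = inR (ℕₚ.+-cancelˡ-≡ k _ _ (trans (sym (toℕ-R b)) (trans xy (trans (cong suc (toℕ-R a)) (sym (ℕₚ.+-suc k _))))))
                              (subst₂ _<_ (toℕ-concatFun-R a) (toℕ-concatFun-R b) asc)

    NoAscent-concatFun : NoAscent v → NoAscent u → NoAscent (concatFun u v)
    NoAscent-concatFun noV noU x y xy asc with ascentView xy asc
    ... | inL ab asc′ = noV _ _ ab asc′
    ... | inR ab asc′ = noU _ _ ab asc′

    IsFirstAscent-L : ∀ {a b} → IsFirstAscent v a b → IsFirstAscent (concatFun u v) (L a) (L b)
    IsFirstAscent-L {a} (ab , asc , first) = Adjacent-L ab , Ascent-L asc , first′
      where
      first′ : ∀ x y → Adjacent x y → toℕ x < toℕ (L a) → ¬ Ascent (concatFun u v) x y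
      first′ x y xy x<a asc′ with ascentView xy asc′
      ... | inL a′b′ asc″ = first _ _ a′b′ (subst₂ _<_ (toℕ-L _) (toℕ-L a) x<a) asc″
      ... | inR _ _ = ℕₚ.<⇒≱ (Finₚ.toℕ<n a)
                        (ℕₚ.≤-trans (ℕₚ.m≤m+n k _) (subst₂ _≤_ (toℕ-R _) (toℕ-L a) (ℕₚ.<⇒≤ x<a)))

    IsFirstAscent-R : NoAscent v → ∀ {a b} → IsFirstAscent u a b → IsFirstAscent (concatFun u v) (R a) (R b)
    IsFirstAscent-R noV {a} (ab , asc , first) = Adjacent-R ab , Ascent-R asc , first′
      where
      first′ : ∀ x y → Adjacent x y → toℕ x < toℕ (R a) → ¬ Ascent (concatFun u v) x y
      first′ x y xy x<a asc′ with ascentView xy asc′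
      ... | inL a′b′ asc″ = noV _ _ a′b′ asc″
      ... | inR a′b′ asc″ = first _ _ a′b′ (ℕₚ.+-cancelˡ-< k _ _ (subst₂ _<_ (toℕ-R _) (toℕ-R a) x<a)) asc″

    swapPos-L : ∀ a b x → swapPos (L a) (L b) (concatFun u v) x ≡ concatFun u (swapPos a b v) x
    swapPos-L a b x = trans (swapPos≗transpose (L a) (L b) (concatFun u v) x) (byView (blockView x))
      where
      byView : ∀ {x} → BlockView x → concatFun u v (PermC.transpose (L a) (L b) x) ≡ concatFun u (swapPos a b v) x
      byView (inL c) = begin
        concatFun u v (PermC.transpose (L a) (L b) (L c))   ≡⟨ cong (concatFun u v) (transpose-map L L-injective a b c) ⟩
        concatFun u v (L (PermC.transpose a b c))           ≡⟨ concatFun-L u v _ ⟩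
        n ↑ʳ v (PermC.transpose a b c)                      ≡⟨ cong (n ↑ʳ_) (swapPos≗transpose a b v c) ⟨
        n ↑ʳ swapPos a b v c                                ≡⟨ concatFun-L u (swapPos a b v) c ⟨
        concatFun u (swapPos a b v) (L c)                    ∎
        where open ≡-Reasoning
      byView (inR c) = trans (cong (concatFun u v) (transpose-fixes R≢L R≢L)) (trans (concatFun-R u v c) (sym (concatFun-R u (swapPos a b v) c)))
        where
        R≢L : ∀ {a} → R c ≢ L a
        R≢L = L≢R ∘ sym

    swapPos-R : ∀ a b x → swapPos (R a) (R b) (concatFun u v) x ≡ concatFun (swapPos a b u) v x
    swapPos-R a b x = trans (swapPos≗transpose (R a) (R b) (concatFun u v) x) (byView (blockView x))
      where
      byView : ∀ {x} → BlockView x → concatFun u v (PermC.transpose (R a) (R b) x) ≡ concatFun (swapPos a b u) v x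
      byView (inL c) = trans (cong (concatFun u v) (transpose-fixes L≢R L≢R)) (trans (concatFun-L u v c) (sym (concatFun-L (swapPos a b u) v c)))
      byView (inR c) = begin
        concatFun u v (PermC.transpose (R a) (R b) (R c))   ≡⟨ cong (concatFun u v) (transpose-map R R-injective a b c) ⟩
        concatFun u v (R (PermC.transpose a b c))           ≡⟨ concatFun-R u v _ ⟩
        u (PermC.transpose a b c) ↑ˡ k                      ≡⟨ cong (_↑ˡ k) (swapPos≗transpose a b u c) ⟨
        swapPos a b u c ↑ˡ k                                ≡⟨ concatFun-R (swapPos a b u) v c ⟨
        concatFun (swapPos a b u) v (R c)                    ∎
        where open ≡-Reasoning

  grothFuel-concatFun-done : ∀ {v} → firstAscentOf v ≡ nothing →
    ∀ f u → grothFuel f (concatFun u v) ↭ shiftedProduct staircase (grothFuel f u)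
  grothFuel-concatFun-done noV zero    u = ↭-reflexive staircase-shiftedProduct
  grothFuel-concatFun-done {v} noV (suc f) u with firstAscentOf u in eq
  ... | nothing = ↭-reflexive (trans (grothFuel-done (suc f) (concatFun u v) concat-done) staircase-shiftedProduct)
    where
    concat-done = NoAscent⇒≡nothing _ (NoAscent-concatFun u v (≡nothing⇒NoAscent v noV) (≡nothing⇒NoAscent u eq))
  ... | just (a , b) = begin
    grothFuel (suc f) (concatFun u v)
      ≡⟨ grothFuel-step f _ (IsFirstAscent⇒≡just _ (IsFirstAscent-R u v (≡nothing⇒NoAscent v noV) (≡just⇒IsFirstAscent u eq))) ⟩
    divDiff (R a) (R b) (oneMinusX (R b) (grothFuel f (swapPos (R a) (R b) (concatFun u v))))
      ≡⟨ cong (divDiff (R a) (R b) ∘ oneMinusX (R b)) (grothFuel-cong f (swapPos-R u v a b)) ⟩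
    divDiff (R a) (R b) (oneMinusX (R b) (grothFuel f (concatFun (swapPos a b u) v)))
      ↭⟨ divDiff-↭ (R a) (R b) (oneMinusX-↭ (R b) (grothFuel-concatFun-done noV f (swapPos a b u))) ⟩
    divDiff (R a) (R b) (oneMinusX (R b) (shiftedProduct staircase (grothFuel f (swapPos a b u))))
      ↭⟨ divDiff-↭ (R a) (R b) (oneMinusX-R b staircase (grothFuel f (swapPos a b u))) ⟩
    divDiff (R a) (R b) (shiftedProduct staircase (oneMinusX b (grothFuel f (swapPos a b u))))
      ≡⟨ divDiff-R a b staircase (oneMinusX b (grothFuel f (swapPos a b u))) ⟩
    shiftedProduct staircase (divDiff a b (oneMinusX b (grothFuel f (swapPos a b u)))) ∎
    where open PermutationReasoning

  grothFuel-concatFun : ∀ {f g u v} → Halts f v → Halts g u →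
    grothFuel (f + g) (concatFun u v) ↭ shiftedProduct (grothFuel f v) (grothFuel g u)
  grothFuel-concatFun {f} {g} {u} {v} (done eq) hu = begin
    grothFuel (f + g) (concatFun u v)                        ↭⟨ grothFuel-concatFun-done eq (f + g) u ⟩
    shiftedProduct staircase (grothFuel (f + g) u)           ≡⟨ cong₂ shiftedProduct (sym (grothFuel-done f v eq))
                                                                                  (grothFuel-stable hu (ℕₚ.m≤n+m g f)) ⟩
    shiftedProduct (grothFuel f v) (grothFuel g u)           ∎
    where open PermutationReasoning
  grothFuel-concatFun {suc f} {g} {u} {v} (step {a = a} {b} eq hv) hu = begin
    grothFuel (suc f + g) (concatFun u v)
      ≡⟨ grothFuel-step (f + g) _ (IsFirstAscent⇒≡just _ (IsFirstAscent-L u v (≡just⇒IsFirstAscent v eq))) ⟩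
    divDiff (L a) (L b) (oneMinusX (L b) (grothFuel (f + g) (swapPos (L a) (L b) (concatFun u v))))
      ≡⟨ cong (divDiff (L a) (L b) ∘ oneMinusX (L b)) (grothFuel-cong (f + g) (swapPos-L u v a b)) ⟩
    divDiff (L a) (L b) (oneMinusX (L b) (grothFuel (f + g) (concatFun u (swapPos a b v))))
      ↭⟨ divDiff-↭ (L a) (L b) (oneMinusX-↭ (L b) (grothFuel-concatFun hv hu)) ⟩
    divDiff (L a) (L b) (oneMinusX (L b) (shiftedProduct (grothFuel f (swapPos a b v)) (grothFuel g u)))
      ≡⟨ cong (divDiff (L a) (L b)) (oneMinusX-L b (grothFuel f (swapPos a b v)) (grothFuel g u)) ⟩
    divDiff (L a) (L b) (shiftedProduct (oneMinusX b (grothFuel f (swapPos a b v))) (grothFuel g u))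
      ↭⟨ divDiff-L a b (oneMinusX b (grothFuel f (swapPos a b v))) (grothFuel g u) ⟩
    shiftedProduct (divDiff a b (oneMinusX b (grothFuel f (swapPos a b v)))) (grothFuel g u)
      ≡⟨ cong (λ z → shiftedProduct z (grothFuel g u)) (grothFuel-step f v eq) ⟨
    shiftedProduct (grothFuel (suc f) v) (grothFuel g u) ∎
    where open PermutationReasoning

  groth-concatPerm : (w : Permutation′ n) (w′ : Permutation′ k) →
    groth {n + k} (concatPerm w w′) ↭ shiftedProduct (groth (w′ ⟨$⟩ʳ_)) (groth (w ⟨$⟩ʳ_))
  groth-concatPerm w w′ = begin
    grothFuel ((n + k) * (n + k)) (concatPerm w w′)       ≡⟨ grothFuel-cong ((n + k) * (n + k)) (concatPerm≗concatFun w w′) ⟩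
    grothFuel ((n + k) * (n + k)) (concatFun u v)         ≡⟨ cong (λ f → grothFuel f (concatFun u v)) fuel-split ⟩
    grothFuel (k * k + rest) (concatFun u v)              ↭⟨ grothFuel-concatFun (groth-Halts v) (Halts-mono (groth-Halts u) n*n≤rest) ⟩
    shiftedProduct (groth v) (grothFuel rest u)           ≡⟨ cong (shiftedProduct (groth v)) (grothFuel-stable (groth-Halts u) n*n≤rest) ⟩
    shiftedProduct (groth v) (groth u)                    ∎
    where
    open PermutationReasoning
    u = w ⟨$⟩ʳ_
    v = w′ ⟨$⟩ʳ_
    rest = n * n + (n * k + k * n)
    n*n≤rest : n * n ≤ rest
    n*n≤rest = ℕₚ.m≤m+n (n * n) _
    fuel-split : (n + k) * (n + k) ≡ k * k + rest
    fuel-split = solve 2 (λ n k → (n :+ k) :* (n :+ k) := k :* k :+ (n :* n :+ (n :* k :+ k :* n))) refl n k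
      where open ℕ-Solver.+-*-Solver

module ProductSupport (n k : ℕ) where

  open Blocks n k
  open Product n k

  shift-injective : ∀ {x x′} → shift x ≡ shift x′ → x ≡ x′
  shift-injective = Vec-map-injective (ℕₚ.+-cancelˡ-≡ n _ _)

  coeff-map-⊗-≡ : ∀ c e₁ e₂ B → coeff (map ((c , e₁) ⊗_) B) (join (shift e₁) e₂) ≡ c ℤ.* coeff B e₂
  coeff-map-⊗-≡ c e₁ e₂ []            = sym (ℤₚ.*-zeroʳ c)
  coeff-map-⊗-≡ c e₁ e₂ ((d , f) ∷ B) with f ≟ₑ e₂
  ... | yes refl = begin
    coeff ((c , e₁) ⊗ (d , f) ∷ map ((c , e₁) ⊗_) B) (join (shift e₁) f)  ≡⟨ coeff-∷-≡ (c ℤ.* d) (join (shift e₁) f) (map ((c , e₁) ⊗_) B) ⟩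
    c ℤ.* d ℤ.+ coeff (map ((c , e₁) ⊗_) B) (join (shift e₁) f)            ≡⟨ cong (ℤ._+_ (c ℤ.* d)) (coeff-map-⊗-≡ c e₁ f B) ⟩
    c ℤ.* d ℤ.+ c ℤ.* coeff B f                                             ≡⟨ ℤₚ.*-distribˡ-+ c d _ ⟨
    c ℤ.* (d ℤ.+ coeff B f)                                                 ∎
    where open ≡-Reasoning
  ... | no f≢e₂ = trans (coeff-∷-≢ (c ℤ.* d) _ (f≢e₂ ∘ proj₂ ∘ join-injective)) (coeff-map-⊗-≡ c e₁ e₂ B)

  coeff-map-⊗-≢ : ∀ c {f₁ e₁} e₂ B → f₁ ≢ e₁ → coeff (map ((c , f₁) ⊗_) B) (join (shift e₁) e₂) ≡ + 0
  coeff-map-⊗-≢ c e₂ []            f₁≢e₁ = refl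
  coeff-map-⊗-≢ c e₂ ((d , f) ∷ B) f₁≢e₁ =
    trans (coeff-∷-≢ (c ℤ.* d) _ (f₁≢e₁ ∘ shift-injective ∘ proj₁ ∘ join-injective)) (coeff-map-⊗-≢ c e₂ B f₁≢e₁)

  coeff-shiftedProduct : ∀ A B e₁ e₂ → coeff (shiftedProduct A B) (join (shift e₁) e₂) ≡ coeff A e₁ ℤ.* coeff B e₂
  coeff-shiftedProduct []            B e₁ e₂ = refl
  coeff-shiftedProduct ((c , f) ∷ A) B e₁ e₂ with f ≟ₑ e₁
  ... | yes refl = begin
    coeff (map ((c , f) ⊗_) B ++ shiftedProduct A B) (join (shift f) e₂)     ≡⟨ coeff-++ (map ((c , f) ⊗_) B) _ _ ⟩
    coeff (map ((c , f) ⊗_) B) (join (shift f) e₂) ℤ.+ coeff (shiftedProduct A B) (join (shift f) e₂)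
      ≡⟨ cong₂ ℤ._+_ (coeff-map-⊗-≡ c f e₂ B) (coeff-shiftedProduct A B f e₂) ⟩
    c ℤ.* coeff B e₂ ℤ.+ coeff A f ℤ.* coeff B e₂                             ≡⟨ ℤₚ.*-distribʳ-+ (coeff B e₂) c _ ⟨
    (c ℤ.+ coeff A f) ℤ.* coeff B e₂                                          ∎
    where open ≡-Reasoning
  ... | no f≢e₁ = begin
    coeff (map ((c , f) ⊗_) B ++ shiftedProduct A B) (join (shift e₁) e₂)    ≡⟨ coeff-++ (map ((c , f) ⊗_) B) _ _ ⟩
    coeff (map ((c , f) ⊗_) B) (join (shift e₁) e₂) ℤ.+ coeff (shiftedProduct A B) (join (shift e₁) e₂)
      ≡⟨ cong₂ ℤ._+_ (coeff-map-⊗-≢ c e₂ B f≢e₁) (coeff-shiftedProduct A B e₁ e₂) ⟩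
    + 0 ℤ.+ coeff A e₁ ℤ.* coeff B e₂                                         ≡⟨ ℤₚ.+-identityˡ _ ⟩
    coeff A e₁ ℤ.* coeff B e₂                                                 ∎
    where open ≡-Reasoning

  shiftedProduct-exponents : ∀ A B → All (λ t → ∃[ e₁ ] ∃[ e₂ ] (proj₂ t ≡ join (shift e₁) e₂)) (shiftedProduct A B)
  shiftedProduct-exponents A B =
    Allₚ.concat⁺ (Allₚ.map⁺ {f = λ t → map (t ⊗_) B} (All.tabulate {xs = A} λ {t} _ →
      Allₚ.map⁺ {f = t ⊗_} (All.tabulate λ {s} _ → proj₂ t , proj₂ s , refl)))

  coeff-shiftedProduct≢0 : ∀ A B {e} → coeff (shiftedProduct A B) e ≢ + 0 → ∃[ e₁ ] ∃[ e₂ ] (e ≡ join (shift e₁) e₂)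
  coeff-shiftedProduct≢0 A B {e} nz =
    All.lookupWith (λ (e₁ , e₂ , t≡) t≡e → e₁ , e₂ , trans (sym t≡e) t≡)
                   (shiftedProduct-exponents A B) (coeff≢0⇒Occurs _ e nz)

  degree-join-shift : ∀ x y → degree (join (shift x) y) ≡ k * n + degree x + degree y
  degree-join-shift x y = begin
    degree (join (shift x) y)                 ≡⟨ sum-cast (ℕₚ.+-comm k n) (shift x Vec.++ y) ⟩
    Vec.sum (shift x Vec.++ y)                ≡⟨ Vecₚ.sum-++ (shift x) ⟩
    Vec.sum (shift x) + Vec.sum y             ≡⟨ cong (_+ Vec.sum y) (sum-map-+ n x) ⟩
    k * n + Vec.sum x + Vec.sum y             ∎
    where open ≡-Reasoning

  *-≢0 : ∀ {a b : ℤ} → a ≢ + 0 → b ≢ + 0 → a ℤ.* b ≢ + 0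
  *-≢0 {a} a≢0 b≢0 ab≡0 = [ a≢0 , b≢0 ]′ (ℤₚ.i*j≡0⇒i≡0∨j≡0 a ab≡0)

  *-≢0⁻ : ∀ {a b : ℤ} → a ℤ.* b ≢ + 0 → a ≢ + 0 × b ≢ + 0
  *-≢0⁻ {a} {b} ab≢0 = (λ { refl → ab≢0 refl }) , (λ { refl → ab≢0 (ℤₚ.*-zeroʳ a) })

  module _ (A : Poly k) (B : Poly n) where

    private
      P = shiftedProduct A B

      coeff-join≢0 : ∀ {e₁ e₂} → coeff A e₁ ≢ + 0 → coeff B e₂ ≢ + 0 → coeff P (join (shift e₁) e₂) ≢ + 0
      coeff-join≢0 {e₁} {e₂} nz₁ nz₂ = *-≢0 nz₁ nz₂ ∘ trans (sym (coeff-shiftedProduct A B e₁ e₂))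

      coeff-join≢0⁻ : ∀ {e₁ e₂} → coeff P (join (shift e₁) e₂) ≢ + 0 → coeff A e₁ ≢ + 0 × coeff B e₂ ≢ + 0
      coeff-join≢0⁻ {e₁} {e₂} nz = *-≢0⁻ (nz ∘ trans (coeff-shiftedProduct A B e₁ e₂))

    TopMonomial-shiftedProduct⁻ : ∀ {e} → TopMonomial P e →
      ∃[ e₁ ] ∃[ e₂ ] (e ≡ join (shift e₁) e₂ × TopMonomial A e₁ × TopMonomial B e₂)
    TopMonomial-shiftedProduct⁻ (nz , top) with coeff-shiftedProduct≢0 A B nz
    ... | e₁ , e₂ , refl = e₁ , e₂ , refl , (nz₁ , top₁) , (nz₂ , top₂)
      where
      nz₁ = proj₁ (coeff-join≢0⁻ nz)
      nz₂ = proj₂ (coeff-join≢0⁻ nz)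
      top₁ : ∀ f → coeff A f ≢ + 0 → degree f ≤ degree e₁
      top₁ f nzf = ℕₚ.+-cancelˡ-≤ (k * n) _ _ (ℕₚ.+-cancelʳ-≤ (degree e₂) _ _
        (subst₂ _≤_ (degree-join-shift f e₂) (degree-join-shift e₁ e₂) (top _ (coeff-join≢0 nzf nz₂))))
      top₂ : ∀ f → coeff B f ≢ + 0 → degree f ≤ degree e₂
      top₂ f nzf = ℕₚ.+-cancelˡ-≤ (k * n + degree e₁) _ _
        (subst₂ _≤_ (degree-join-shift e₁ f) (degree-join-shift e₁ e₂) (top _ (coeff-join≢0 nz₁ nzf)))

    TopMonomial-shiftedProduct⁺ : ∀ {e₁ e₂} → TopMonomial A e₁ → TopMonomial B e₂ → TopMonomial P (join (shift e₁) e₂)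
    TopMonomial-shiftedProduct⁺ {e₁} {e₂} (nz₁ , top₁) (nz₂ , top₂) = coeff-join≢0 nz₁ nz₂ , top
      where
      top : ∀ f → coeff P f ≢ + 0 → degree f ≤ degree (join (shift e₁) e₂)
      top f nz with coeff-shiftedProduct≢0 A B nz
      ... | f₁ , f₂ , refl = subst₂ _≤_ (sym (degree-join-shift f₁ f₂)) (sym (degree-join-shift e₁ e₂))
        (ℕₚ.+-mono-≤ (ℕₚ.+-monoʳ-≤ (k * n) (top₁ f₁ (proj₁ (coeff-join≢0⁻ nz)))) (top₂ f₂ (proj₂ (coeff-join≢0⁻ nz))))


-- Convex hulls

∑ : ∀ {A : Set} → List A → (A → ℚ) → ℚ
∑ xs f = List.foldr ℚ._+_ 0ℚ (map f xs)

module _ {A : Set} where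

  ∑-cong : ∀ (xs : List A) {f g : A → ℚ} → (∀ x → f x ≡ g x) → ∑ xs f ≡ ∑ xs g
  ∑-cong xs f≗g = cong (List.foldr ℚ._+_ 0ℚ) (Listₚ.map-cong f≗g xs)

  ∑-++ : ∀ (xs ys : List A) f → ∑ (xs ++ ys) f ≡ ∑ xs f ℚ.+ ∑ ys f
  ∑-++ []       ys f = sym (ℚₚ.+-identityˡ _)
  ∑-++ (x ∷ xs) ys f = trans (cong (ℚ._+_ (f x)) (∑-++ xs ys f)) (sym (ℚₚ.+-assoc (f x) _ _))

  ∑-*ˡ : ∀ (xs : List A) a f → ∑ xs (λ x → a ℚ.* f x) ≡ a ℚ.* ∑ xs f
  ∑-*ˡ []       a f = sym (ℚₚ.*-zeroʳ a)
  ∑-*ˡ (x ∷ xs) a f = trans (cong (ℚ._+_ (a ℚ.* f x)) (∑-*ˡ xs a f)) (sym (ℚₚ.*-distribˡ-+ a (f x) _))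

  ∑-*ʳ : ∀ (xs : List A) a f → ∑ xs (λ x → f x ℚ.* a) ≡ ∑ xs f ℚ.* a
  ∑-*ʳ xs a f = trans (∑-cong xs (λ x → ℚₚ.*-comm (f x) a)) (trans (∑-*ˡ xs a f) (ℚₚ.*-comm a _))

  ∑-+ : ∀ (xs : List A) f g → ∑ xs (λ x → f x ℚ.+ g x) ≡ ∑ xs f ℚ.+ ∑ xs g
  ∑-+ []       f g = refl
  ∑-+ (x ∷ xs) f g = trans (cong (ℚ._+_ (f x ℚ.+ g x)) (∑-+ xs f g))
    (solve 4 (λ a b c d → (a :+ b) :+ (c :+ d) := (a :+ c) :+ (b :+ d)) refl (f x) (g x) (∑ xs f) (∑ xs g))
    where open ℚ-Solver.+-*-Solver

  ∑-mono-≤ : ∀ (xs : List A) {f g} → All (λ x → f x ℚ.≤ g x) xs → ∑ xs f ℚ.≤ ∑ xs g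
  ∑-mono-≤ []       []          = ℚₚ.≤-refl
  ∑-mono-≤ (x ∷ xs) (fx≤gx ∷ h) = ℚₚ.+-mono-≤ fx≤gx (∑-mono-≤ xs h)

∑-map : ∀ {A B : Set} (h : A → B) xs f → ∑ (map h xs) f ≡ ∑ xs (f ∘ h)
∑-map h xs f = cong (List.foldr ℚ._+_ 0ℚ) (sym (Listₚ.map-∘ xs))

∑-concatMap : ∀ {A B : Set} (g : A → List B) xs f → ∑ (concatMap g xs) f ≡ ∑ xs (λ x → ∑ (g x) f)
∑-concatMap g []       f = refl
∑-concatMap g (x ∷ xs) f = trans (∑-++ (g x) _ f) (cong (ℚ._+_ (∑ (g x) f)) (∑-concatMap g xs f))

lookup-combo : ∀ {N} (ws : List (ℚ × Point N)) i → lookup (combo ws) i ≡ ∑ ws (λ (l , x) → l ℚ.* lookup x i)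
lookup-combo []             i = Vecₚ.lookup-replicate i 0ℚ
lookup-combo ((l , x) ∷ ws) i = trans (Vecₚ.lookup-zipWith ℚ._+_ i (Vec.map (l ℚ.*_) x) (combo ws))
                                      (cong₂ ℚ._+_ (Vecₚ.lookup-map i (l ℚ.*_) x) (lookup-combo ws i))

ConvHull-mono : ∀ {N} {S S′ : Point N → Set} → (∀ y → S y → S′ y) → ∀ x → ConvHull S x → ConvHull S′ x
ConvHull-mono S⊆S′ x (ws , valid , ∑1 , x≡) = ws , All.map (λ (0≤l , Sy) → 0≤l , S⊆S′ _ Sy) valid , ∑1 , x≡

ConvHull-singleton : ∀ {N} (S : Point N → Set) x → S x → ConvHull S x
ConvHull-singleton S x Sx = (1ℚ , x) ∷ [] , (ℚ.*≤* (ℤ.+≤+ z≤n) , Sx) ∷ [] , ℚₚ.+-identityʳ 1ℚ ,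
  Pointwise-≡⇒≡ (ext λ i → trans (lookup-combo ((1ℚ , x) ∷ []) i) (trans (ℚₚ.+-identityʳ _) (ℚₚ.*-identityˡ _)))

ConvHull-lookup-≤ : ∀ {N} (S : Point N → Set) i c → (∀ y → S y → lookup y i ℚ.≤ c) → ∀ x → ConvHull S x → lookup x i ℚ.≤ c
ConvHull-lookup-≤ S i c bound x (ws , valid , ∑1 , refl) = begin
  lookup (combo ws) i                     ≡⟨ lookup-combo ws i ⟩
  ∑ ws (λ (l , y) → l ℚ.* lookup y i)     ≤⟨ ∑-mono-≤ ws (All.map (λ {(l , y)} (0≤l , Sy) → ℚₚ.*-monoˡ-≤-nonNeg l {{ℚ.nonNegative 0≤l}} (bound y Sy)) valid) ⟩
  ∑ ws (λ (l , _) → l ℚ.* c)              ≡⟨ ∑-*ʳ ws c proj₁ ⟩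
  ∑ ws proj₁ ℚ.* c                        ≡⟨ cong (ℚ._* c) ∑1 ⟩
  1ℚ ℚ.* c                                ≡⟨ ℚₚ.*-identityˡ c ⟩
  c                                       ∎
  where open ℚₚ.≤-Reasoning

ℕtoℚ : ℕ → ℚ
ℕtoℚ m = + m ℚ./ 1

private
  ℕtoℚ≃ : ∀ m → ℚ.toℚᵘ (ℕtoℚ m) ℚᵘ.≃ ℚᵘ.mkℚᵘ (+ m) 0
  ℕtoℚ≃ m = ℚₚ.toℚᵘ-fromℚᵘ (ℚᵘ.mkℚᵘ (+ m) 0)

ℕtoℚ-+ : ∀ a b → ℕtoℚ (a + b) ≡ ℕtoℚ a ℚ.+ ℕtoℚ b
ℕtoℚ-+ a b = ℚₚ.toℚᵘ-injective (ℚᵘₚ.≃-trans (ℕtoℚ≃ (a + b)) (ℚᵘₚ.≃-trans sum≃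
  (ℚᵘₚ.≃-sym (ℚᵘₚ.≃-trans (ℚₚ.toℚᵘ-homo-+ (ℕtoℚ a) (ℕtoℚ b)) (ℚᵘₚ.+-cong (ℕtoℚ≃ a) (ℕtoℚ≃ b))))))
  where
  sum≃ : ℚᵘ.mkℚᵘ (+ (a + b)) 0 ℚᵘ.≃ ℚᵘ.mkℚᵘ (+ a) 0 ℚᵘ.+ ℚᵘ.mkℚᵘ (+ b) 0
  sum≃ = ℚᵘ.*≡* (cong (ℤ._* + 1) (sym (cong₂ ℤ._+_ (ℤₚ.*-identityʳ (+ a)) (ℤₚ.*-identityʳ (+ b)))))

ℕtoℚ-mono-≤ : ∀ {a b} → a ≤ b → ℕtoℚ a ℚ.≤ ℕtoℚ b
ℕtoℚ-mono-≤ {a} {b} a≤b = ℚₚ.toℚᵘ-cancel-≤ (ℚᵘₚ.≤-respˡ-≃ (ℚᵘₚ.≃-sym (ℕtoℚ≃ a)) (ℚᵘₚ.≤-respʳ-≃ (ℚᵘₚ.≃-sym (ℕtoℚ≃ b))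
  (ℚᵘ.*≤* (subst₂ ℤ._≤_ (sym (ℤₚ.*-identityʳ (+ a))) (sym (ℤₚ.*-identityʳ (+ b))) (ℤ.+≤+ a≤b)))))

ℕtoℚ-cancel-≤ : ∀ {a b} → ℕtoℚ a ℚ.≤ ℕtoℚ b → a ≤ b
ℕtoℚ-cancel-≤ {a} {b} le with ℚᵘₚ.≤-respʳ-≃ (ℕtoℚ≃ b) (ℚᵘₚ.≤-respˡ-≃ (ℕtoℚ≃ a) (ℚₚ.toℚᵘ-mono-≤ le))
... | ℚᵘ.*≤* le′ with subst₂ ℤ._≤_ (ℤₚ.*-identityʳ (+ a)) (ℤₚ.*-identityʳ (+ b)) le′
...   | ℤ.+≤+ a≤b = a≤b

lookup-toPoint : ∀ {N} (e : Exp N) i → lookup (toPoint e) i ≡ ℕtoℚ (lookup e i)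
lookup-toPoint e i = Vecₚ.lookup-map i ℕtoℚ e

module ShiftedHull (n k : ℕ) where

  open Blocks n k

  Triple : Set
  Triple = ℚ × Point k × Point n

  shiftedJoin : Point k → Point n → Point (n + k)
  shiftedJoin y₁ y₂ = join (Vec.map (ℚ._+_ (ℕtoℚ n)) y₁) y₂

  lookup-shiftedJoin-L : ∀ y₁ y₂ a → lookup (shiftedJoin y₁ y₂) (L a) ≡ ℕtoℚ n ℚ.+ lookup y₁ a
  lookup-shiftedJoin-L y₁ y₂ a = trans (lookup-join-L _ y₂ a) (Vecₚ.lookup-map a _ y₁)

  lookup-shiftedJoin-R : ∀ y₁ y₂ b → lookup (shiftedJoin y₁ y₂) (R b) ≡ lookup y₂ b
  lookup-shiftedJoin-R y₁ y₂ b = lookup-join-R _ y₂ b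

  ShiftedProduct : (Point k → Set) → (Point n → Set) → Point (n + k) → Set
  ShiftedProduct S₁ S₂ x = ∃[ y₁ ] ∃[ y₂ ] (S₁ y₁ × S₂ y₂ × x ≡ shiftedJoin y₁ y₂)

  ShiftedProduct-mono : ∀ {S₁ S₁′ S₂ S₂′} → (∀ y → S₁ y → S₁′ y) → (∀ y → S₂ y → S₂′ y) →
                        ∀ x → ShiftedProduct S₁ S₂ x → ShiftedProduct S₁′ S₂′ x
  ShiftedProduct-mono f g x (y₁ , y₂ , s₁ , s₂ , x≡) = y₁ , y₂ , f y₁ s₁ , g y₂ s₂ , x≡

  joined : Triple → ℚ × Point (n + k)
  joined t = proj₁ t , shiftedJoin (proj₁ (proj₂ t)) (proj₂ (proj₂ t))

  first : Triple → ℚ × Point k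
  first t = proj₁ t , proj₁ (proj₂ t)

  second : Triple → ℚ × Point n
  second t = proj₁ t , proj₂ (proj₂ t)

  combo-shiftedJoin : ∀ ts → ∑ ts proj₁ ≡ 1ℚ →
    combo (map joined ts) ≡ shiftedJoin (combo (map first ts)) (combo (map second ts))
  combo-shiftedJoin ts ∑1 = ≡-byBlocks onL onR
    where
    c = ℕtoℚ n
    onL : ∀ a → lookup (combo (map joined ts)) (L a) ≡ lookup (shiftedJoin (combo (map first ts)) (combo (map second ts))) (L a)
    onL a = begin
      lookup (combo (map joined ts)) (L a)
        ≡⟨ trans (lookup-combo (map joined ts) (L a)) (∑-map joined ts _) ⟩
      ∑ ts (λ (l , y₁ , y₂) → l ℚ.* lookup (shiftedJoin y₁ y₂) (L a))
        ≡⟨ ∑-cong ts (λ (l , y₁ , y₂) → cong (ℚ._*_ l) (lookup-shiftedJoin-L y₁ y₂ a)) ⟩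
      ∑ ts (λ (l , y₁ , _) → l ℚ.* (c ℚ.+ lookup y₁ a))
        ≡⟨ trans (∑-cong ts (λ (l , _) → ℚₚ.*-distribˡ-+ l c _)) (∑-+ ts _ _) ⟩
      ∑ ts (λ (l , _) → l ℚ.* c) ℚ.+ ∑ ts (λ (l , y₁ , _) → l ℚ.* lookup y₁ a)
        ≡⟨ cong₂ ℚ._+_ (trans (∑-*ʳ ts c proj₁) (trans (cong (ℚ._* c) ∑1) (ℚₚ.*-identityˡ c)))
                       (sym (trans (lookup-combo (map first ts) a) (∑-map first ts _))) ⟩
      c ℚ.+ lookup (combo (map first ts)) a
        ≡⟨ lookup-shiftedJoin-L (combo (map first ts)) (combo (map second ts)) a ⟨
      lookup (shiftedJoin (combo (map first ts)) (combo (map second ts))) (L a) ∎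
      where open ≡-Reasoning
    onR : ∀ b → lookup (combo (map joined ts)) (R b) ≡ lookup (shiftedJoin (combo (map first ts)) (combo (map second ts))) (R b)
    onR b = begin
      lookup (combo (map joined ts)) (R b)
        ≡⟨ trans (lookup-combo (map joined ts) (R b)) (∑-map joined ts _) ⟩
      ∑ ts (λ (l , y₁ , y₂) → l ℚ.* lookup (shiftedJoin y₁ y₂) (R b))
        ≡⟨ ∑-cong ts (λ (l , y₁ , y₂) → cong (ℚ._*_ l) (lookup-shiftedJoin-R y₁ y₂ b)) ⟩
      ∑ ts (λ (l , _ , y₂) → l ℚ.* lookup y₂ b)
        ≡⟨ trans (lookup-combo (map second ts) b) (∑-map second ts _) ⟨
      lookup (combo (map second ts)) b
        ≡⟨ lookup-shiftedJoin-R (combo (map first ts)) (combo (map second ts)) b ⟨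
      lookup (shiftedJoin (combo (map first ts)) (combo (map second ts))) (R b) ∎
      where open ≡-Reasoning

  pairUp : List (ℚ × Point k) → List (ℚ × Point n) → List Triple
  pairUp ws₁ ws₂ = concatMap (λ t₁ → map (λ t₂ → proj₁ t₁ ℚ.* proj₁ t₂ , proj₂ t₁ , proj₂ t₂) ws₂) ws₁

  ∑-pairUp : ∀ ws₁ ws₂ (g : Point k → Point n → ℚ) →
    ∑ (pairUp ws₁ ws₂) (λ (l , y₁ , y₂) → l ℚ.* g y₁ y₂) ≡ ∑ ws₁ (λ (l₁ , y₁) → l₁ ℚ.* ∑ ws₂ (λ (l₂ , y₂) → l₂ ℚ.* g y₁ y₂))
  ∑-pairUp ws₁ ws₂ g = begin
    ∑ (pairUp ws₁ ws₂) (λ (l , y₁ , y₂) → l ℚ.* g y₁ y₂)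
      ≡⟨ ∑-concatMap _ ws₁ _ ⟩
    ∑ ws₁ (λ (l₁ , y₁) → ∑ (map (λ (l₂ , y₂) → l₁ ℚ.* l₂ , y₁ , y₂) ws₂) (λ (l , y₁ , y₂) → l ℚ.* g y₁ y₂))
      ≡⟨ ∑-cong ws₁ (λ (l₁ , y₁) → trans (∑-map _ ws₂ _) (∑-cong ws₂ λ (l₂ , y₂) → ℚₚ.*-assoc l₁ l₂ _)) ⟩
    ∑ ws₁ (λ (l₁ , y₁) → ∑ ws₂ (λ (l₂ , y₂) → l₁ ℚ.* (l₂ ℚ.* g y₁ y₂)))
      ≡⟨ ∑-cong ws₁ (λ (l₁ , y₁) → ∑-*ˡ ws₂ l₁ _) ⟩
    ∑ ws₁ (λ (l₁ , y₁) → l₁ ℚ.* ∑ ws₂ (λ (l₂ , y₂) → l₂ ℚ.* g y₁ y₂)) ∎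
    where open ≡-Reasoning

  ∑-weighted-const : ∀ {N} (ws : List (ℚ × Point N)) → ∑ ws proj₁ ≡ 1ℚ → ∀ c → ∑ ws (λ (l , _) → l ℚ.* c) ≡ c
  ∑-weighted-const ws ∑1 c = trans (∑-*ʳ ws c proj₁) (trans (cong (ℚ._* c) ∑1) (ℚₚ.*-identityˡ c))

  module _ (ws₁ : List (ℚ × Point k)) (ws₂ : List (ℚ × Point n)) where

    ∑-pairUp-weights : ∑ ws₁ proj₁ ≡ 1ℚ → ∑ ws₂ proj₁ ≡ 1ℚ → ∑ (pairUp ws₁ ws₂) proj₁ ≡ 1ℚ
    ∑-pairUp-weights ∑1₁ ∑1₂ = begin
      ∑ (pairUp ws₁ ws₂) proj₁                                  ≡⟨ ∑-cong (pairUp ws₁ ws₂) (λ (l , _) → sym (ℚₚ.*-identityʳ l)) ⟩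
      ∑ (pairUp ws₁ ws₂) (λ (l , _) → l ℚ.* 1ℚ)                 ≡⟨ ∑-pairUp ws₁ ws₂ (λ _ _ → 1ℚ) ⟩
      ∑ ws₁ (λ (l₁ , _) → l₁ ℚ.* ∑ ws₂ (λ (l₂ , _) → l₂ ℚ.* 1ℚ)) ≡⟨ ∑-cong ws₁ (λ (l₁ , _) → cong (ℚ._*_ l₁) (∑-weighted-const ws₂ ∑1₂ 1ℚ)) ⟩
      ∑ ws₁ (λ (l₁ , _) → l₁ ℚ.* 1ℚ)                            ≡⟨ ∑-weighted-const ws₁ ∑1₁ 1ℚ ⟩
      1ℚ                                                         ∎
      where open ≡-Reasoning

    combo-first-pairUp : ∑ ws₂ proj₁ ≡ 1ℚ → combo (map first (pairUp ws₁ ws₂)) ≡ combo ws₁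
    combo-first-pairUp ∑1₂ = Pointwise-≡⇒≡ (ext λ i → begin
      lookup (combo (map first (pairUp ws₁ ws₂))) i
        ≡⟨ trans (lookup-combo (map first (pairUp ws₁ ws₂)) i) (∑-map first (pairUp ws₁ ws₂) _) ⟩
      ∑ (pairUp ws₁ ws₂) (λ (l , y₁ , _) → l ℚ.* lookup y₁ i)
        ≡⟨ ∑-pairUp ws₁ ws₂ (λ y₁ _ → lookup y₁ i) ⟩
      ∑ ws₁ (λ (l₁ , y₁) → l₁ ℚ.* ∑ ws₂ (λ (l₂ , _) → l₂ ℚ.* lookup y₁ i))
        ≡⟨ ∑-cong ws₁ (λ (l₁ , y₁) → cong (ℚ._*_ l₁) (∑-weighted-const ws₂ ∑1₂ (lookup y₁ i))) ⟩
      ∑ ws₁ (λ (l₁ , y₁) → l₁ ℚ.* lookup y₁ i)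
        ≡⟨ lookup-combo ws₁ i ⟨
      lookup (combo ws₁) i ∎)
      where open ≡-Reasoning

    combo-second-pairUp : ∑ ws₁ proj₁ ≡ 1ℚ → combo (map second (pairUp ws₁ ws₂)) ≡ combo ws₂
    combo-second-pairUp ∑1₁ = Pointwise-≡⇒≡ (ext λ i → begin
      lookup (combo (map second (pairUp ws₁ ws₂))) i
        ≡⟨ trans (lookup-combo (map second (pairUp ws₁ ws₂)) i) (∑-map second (pairUp ws₁ ws₂) _) ⟩
      ∑ (pairUp ws₁ ws₂) (λ (l , _ , y₂) → l ℚ.* lookup y₂ i)
        ≡⟨ ∑-pairUp ws₁ ws₂ (λ _ y₂ → lookup y₂ i) ⟩
      ∑ ws₁ (λ (l₁ , _) → l₁ ℚ.* ∑ ws₂ (λ (l₂ , y₂) → l₂ ℚ.* lookup y₂ i))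
        ≡⟨ ∑-weighted-const ws₁ ∑1₁ _ ⟩
      ∑ ws₂ (λ (l₂ , y₂) → l₂ ℚ.* lookup y₂ i)
        ≡⟨ lookup-combo ws₂ i ⟨
      lookup (combo ws₂) i ∎)
      where open ≡-Reasoning

  module _ {S₁ : Point k → Set} {S₂ : Point n → Set} where

    ValidTriple : Triple → Set
    ValidTriple (l , y₁ , y₂) = 0ℚ ℚ.≤ l × S₁ y₁ × S₂ y₂

    private
      triples : ∀ ws → All (λ t → 0ℚ ℚ.≤ proj₁ t × ShiftedProduct S₁ S₂ (proj₂ t)) ws →
                ∃[ ts ] (map joined ts ≡ ws × All ValidTriple ts)
      triples []       []                                          = [] , refl , []
      triples (_ ∷ ws) ((0≤l , y₁ , y₂ , s₁ , s₂ , refl) ∷ valid) with triples ws valid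
      ... | ts , refl , valid′ = (_ , y₁ , y₂) ∷ ts , refl , (0≤l , s₁ , s₂) ∷ valid′

    ConvHull-ShiftedProduct⁻ : ∀ x → ConvHull (ShiftedProduct S₁ S₂) x → ShiftedProduct (ConvHull S₁) (ConvHull S₂) x
    ConvHull-ShiftedProduct⁻ x (ws , valid , ∑1 , refl) with triples ws valid
    ... | ts , refl , valid′ =
        combo (map first ts) , combo (map second ts)
      , (map first ts , Allₚ.map⁺ (All.map (λ (0≤l , s₁ , _) → 0≤l , s₁) valid′) , trans (∑-map first ts proj₁) ∑1′ , refl)
      , (map second ts , Allₚ.map⁺ (All.map (λ (0≤l , _ , s₂) → 0≤l , s₂) valid′) , trans (∑-map second ts proj₁) ∑1′ , refl)
      , combo-shiftedJoin ts ∑1′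
      where
      ∑1′ : ∑ ts proj₁ ≡ 1ℚ
      ∑1′ = trans (sym (∑-map joined ts proj₁)) ∑1

    ConvHull-ShiftedProduct⁺ : ∀ x → ShiftedProduct (ConvHull S₁) (ConvHull S₂) x → ConvHull (ShiftedProduct S₁ S₂) x
    ConvHull-ShiftedProduct⁺ x (_ , _ , (ws₁ , valid₁ , ∑1₁ , refl) , (ws₂ , valid₂ , ∑1₂ , refl) , refl) =
        map joined ts
      , Allₚ.map⁺ (All.map (λ {t} (0≤l , s₁ , s₂) → 0≤l , proj₁ (proj₂ t) , proj₂ (proj₂ t) , s₁ , s₂ , refl) valid)
      , trans (∑-map joined ts proj₁) (∑-pairUp-weights ws₁ ws₂ ∑1₁ ∑1₂)
      , trans (combo-shiftedJoin ts (∑-pairUp-weights ws₁ ws₂ ∑1₁ ∑1₂))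
              (cong₂ shiftedJoin (combo-first-pairUp ws₁ ws₂ ∑1₂) (combo-second-pairUp ws₁ ws₂ ∑1₁))
      where
      ts = pairUp ws₁ ws₂
      valid : All ValidTriple ts
      valid = Allₚ.concat⁺ (Allₚ.map⁺ (All.map (λ {(l₁ , _)} (0≤l₁ , s₁) → Allₚ.map⁺ (All.map (λ {(l₂ , _)} (0≤l₂ , s₂) →
                ℚₚ.nonNegative⁻¹ _ {{ℚₚ.nonNeg*nonNeg⇒nonNeg l₁ {{ℚ.nonNegative 0≤l₁}} l₂ {{ℚ.nonNegative 0≤l₂}}}} , s₁ , s₂) valid₂)) valid₁))

  ConvHull-ShiftedProduct-cong : ∀ {S T : Point (n + k) → Set} {S₁ T₁ : Point k → Set} {S₂ T₂ : Point n → Set} →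
    SamePolytope S (ShiftedProduct S₁ S₂) → SamePolytope T (ShiftedProduct T₁ T₂) →
    SamePolytope (ConvHull S₁) (ConvHull T₁) → SamePolytope (ConvHull S₂) (ConvHull T₂) →
    SamePolytope (ConvHull S) (ConvHull T)
  ConvHull-ShiftedProduct-cong S≐ T≐ same₁ same₂ x = transfer S≐ T≐ same₁ same₂ , transfer T≐ S≐ (flip same₁) (flip same₂)
    where
    flip : ∀ {N} {P Q : Point N → Set} → SamePolytope P Q → SamePolytope Q P
    flip same y = proj₂ (same y) , proj₁ (same y)
    transfer : ∀ {S T S₁ T₁ S₂ T₂} → SamePolytope S (ShiftedProduct S₁ S₂) → SamePolytope T (ShiftedProduct T₁ T₂) →
               SamePolytope (ConvHull S₁) (ConvHull T₁) → SamePolytope (ConvHull S₂) (ConvHull T₂) → ConvHull S x → ConvHull T x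
    transfer S≐ T≐ same₁ same₂ =
        ConvHull-mono (λ y → proj₂ (T≐ y)) x
      ∘ ConvHull-ShiftedProduct⁺ x
      ∘ ShiftedProduct-mono (λ y → proj₁ (same₁ y)) (λ y → proj₁ (same₂ y)) x
      ∘ ConvHull-ShiftedProduct⁻ x
      ∘ ConvHull-mono (λ y → proj₁ (S≐ y)) x


-- Columns and weights of diagrams

count : ∀ {M} → (Fin M → Bool) → ℕ
count {zero}  f = 0
count {suc M} f = if f Fin.zero then suc (count (f ∘ Fin.suc)) else count (f ∘ Fin.suc)

count-cong : ∀ {M} {f g : Fin M → Bool} → (∀ j → f j ≡ g j) → count f ≡ count g
count-cong {zero}  f≗g = refl
count-cong {suc M} {f} {g} f≗g rewrite f≗g Fin.zero | count-cong (f≗g ∘ Fin.suc) = refl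

count-++ : ∀ a {b} (f : Fin (a + b) → Bool) → count f ≡ count (λ j → f (j ↑ˡ b)) + count (λ j → f (a ↑ʳ j))
count-++ zero    f = refl
count-++ (suc a) f with f Fin.zero
... | true  = cong suc (count-++ a (f ∘ Fin.suc))
... | false = count-++ a (f ∘ Fin.suc)

count-false : ∀ {M} {f : Fin M → Bool} → (∀ j → f j ≡ false) → count f ≡ 0
count-false {zero}  _   = refl
count-false {suc M} {f} all-false rewrite all-false Fin.zero = count-false (all-false ∘ Fin.suc)

count-<ᵇ : ∀ M {t} → t ≤ M → count {M} (λ p → toℕ p <ᵇ t) ≡ t
count-<ᵇ zero    z≤n       = refl
count-<ᵇ (suc M) z≤n       = count-false {M} (λ _ → refl)
count-<ᵇ (suc M) (s≤s t≤M) = cong suc (count-<ᵇ M t≤M)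

trues : ∀ {M} → (Fin M → Bool) → List (Fin M)
trues {M} f = filter (λ i → f i Bool.≟ true) (allFin M)

private
  filter-tabulate-suc : ∀ {M} (f : Fin (suc M) → Bool) →
    filter (λ i → f i Bool.≟ true) (List.tabulate {n = M} Fin.suc) ≡ map Fin.suc (trues (f ∘ Fin.suc))
  filter-tabulate-suc {M} f =
    trans (cong (filter _) (sym (Listₚ.map-tabulate (λ i → i) Fin.suc))) (filter-map (λ i → f i Bool.≟ true) Fin.suc (allFin M))

trues-suc : ∀ {M} (f : Fin (suc M) → Bool) →
  trues f ≡ (if f Fin.zero then Fin.zero ∷ map Fin.suc (trues (f ∘ Fin.suc)) else map Fin.suc (trues (f ∘ Fin.suc)))
trues-suc {M} f with f Fin.zero
... | true  = cong (Fin.zero ∷_) (filter-tabulate-suc f)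
... | false = filter-tabulate-suc f

length-trues : ∀ {M} (f : Fin M → Bool) → length (trues f) ≡ count f
length-trues {zero}  f = refl
length-trues {suc M} f rewrite trues-suc f with f Fin.zero
... | true  = cong suc (trans (Listₚ.length-map Fin.suc (trues (f ∘ Fin.suc))) (length-trues (f ∘ Fin.suc)))
... | false = trans (Listₚ.length-map Fin.suc (trues (f ∘ Fin.suc))) (length-trues (f ∘ Fin.suc))

count≤ : ∀ {M} (f : Fin M → Bool) → count f ≤ M
count≤ {zero}  f = z≤n
count≤ {suc M} f with f Fin.zero
... | true  = s≤s (count≤ (f ∘ Fin.suc))
... | false = ℕₚ.m≤n⇒m≤1+n (count≤ (f ∘ Fin.suc))

count≡0⇒false : ∀ {M} (f : Fin M → Bool) → count f ≡ 0 → ∀ i → f i ≡ false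
count≡0⇒false {suc M} f eq i with f Fin.zero in f0
count≡0⇒false {suc M} f () i           | true
count≡0⇒false {suc M} f eq Fin.zero    | false = f0
count≡0⇒false {suc M} f eq (Fin.suc i) | false = count≡0⇒false (f ∘ Fin.suc) eq i

count≡M⇒true : ∀ {M} (f : Fin M → Bool) → count f ≡ M → ∀ i → f i ≡ true
count≡M⇒true {suc M} f eq i with f Fin.zero in f0
count≡M⇒true {suc M} f eq Fin.zero    | true  = f0
count≡M⇒true {suc M} f eq (Fin.suc i) | true  = count≡M⇒true (f ∘ Fin.suc) (ℕₚ.suc-injective eq) i
count≡M⇒true {suc M} f eq _           | false = ⊥-elim (ℕₚ.n≮n M (subst (_≤ M) eq (count≤ (f ∘ Fin.suc))))

trues-cong : ∀ {M} {f g : Fin M → Bool} → (∀ i → f i ≡ g i) → trues f ≡ trues g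
trues-cong {M} {f} {g} f≗g = Listₚ.filter-≐ (λ i → f i Bool.≟ true) (λ i → g i Bool.≟ true)
  ((λ {i} fi → trans (sym (f≗g i)) fi) , (λ {i} gi → trans (f≗g i) gi)) (allFin M)

trues-false : ∀ {M} {f : Fin M → Bool} → (∀ i → f i ≡ false) → trues f ≡ []
trues-false {M} {f} all-false = Listₚ.filter-none (λ i → f i Bool.≟ true)
  (Allₚ.tabulate⁺ λ i fi → case trans (sym (all-false i)) fi of λ ())

trues-true : ∀ {M} {f : Fin M → Bool} → (∀ i → f i ≡ true) → trues f ≡ allFin M
trues-true {M} {f} all-true = Listₚ.filter-all (λ i → f i Bool.≟ true) (Allₚ.tabulate⁺ all-true)

trues≡[]⇒false : ∀ {M} (f : Fin M → Bool) → trues f ≡ [] → ∀ i → f i ≡ false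
trues≡[]⇒false f eq = count≡0⇒false f (trans (sym (length-trues f)) (cong length eq))

length-trues≡⇒true : ∀ {M} (f : Fin M → Bool) → length (trues f) ≡ M → ∀ i → f i ≡ true
length-trues≡⇒true f eq = count≡M⇒true f (trans (sym (length-trues f)) eq)

lookup-wt : ∀ {N m} (C : Diagram N m) i → lookup (wt C) i ≡ count (C i)
lookup-wt C i = trans (Vecₚ.lookup∘tabulate _ i) (length-trues (C i))

wt-cong : ∀ {N m} {C C′ : Diagram N m} → (∀ i j → C i j ≡ C′ i j) → wt C ≡ wt C′
wt-cong {C = C} {C′} C≗C′ = Vecₚ.tabulate-cong λ i →
  trans (length-trues (C i)) (trans (count-cong (C≗C′ i)) (sym (length-trues (C′ i))))

topJustified : ∀ {M} → ℕ → Fin M → Bool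
topJustified ℓ i = toℕ i <ᵇ ℓ

upTo-suc : ∀ ℓ → upTo (suc ℓ) ≡ 0 ∷ map suc (upTo ℓ)
upTo-suc ℓ = cong (0 ∷_) (sym (Listₚ.map-applyUpTo (λ i → i) suc ℓ))

map-toℕ-suc : ∀ {M} (xs : List (Fin M)) → map suc (map toℕ xs) ≡ map toℕ (map Fin.suc xs)
map-toℕ-suc xs = trans (sym (Listₚ.map-∘ xs)) (Listₚ.map-∘ xs)

toℕ-trues-topJustified : ∀ M {ℓ} → ℓ ≤ M → map toℕ (trues {M} (topJustified ℓ)) ≡ upTo ℓ
toℕ-trues-topJustified M       z≤n       = cong (map toℕ) (trues-false {M} λ _ → refl)
toℕ-trues-topJustified (suc M) {suc ℓ} (s≤s ℓ≤M) = begin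
  map toℕ (trues (topJustified (suc ℓ)))                  ≡⟨ cong (map toℕ) (trues-suc (topJustified (suc ℓ))) ⟩
  0 ∷ map toℕ (map Fin.suc (trues (topJustified ℓ)))     ≡⟨ cong (0 ∷_) (map-toℕ-suc (trues (topJustified ℓ))) ⟨
  0 ∷ map suc (map toℕ (trues (topJustified ℓ)))         ≡⟨ cong (λ z → 0 ∷ map suc z) (toℕ-trues-topJustified M ℓ≤M) ⟩
  0 ∷ map suc (upTo ℓ)                                   ≡⟨ upTo-suc ℓ ⟨
  upTo (suc ℓ)                                           ∎
  where open ≡-Reasoning

upTo≤toℕ-trues : ∀ {M} (f : Fin M → Bool) → Pointwise _≤_ (upTo (count f)) (map toℕ (trues f))
upTo≤toℕ-trues {zero}  f = []
upTo≤toℕ-trues {suc M} f rewrite trues-suc f with f Fin.zero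
... | true  = subst₂ (Pointwise _≤_) (sym (upTo-suc (count (f ∘ Fin.suc)))) (cong (0 ∷_) (map-toℕ-suc (trues (f ∘ Fin.suc))))
                (z≤n ∷ Pointwise.map⁺ suc suc (Pointwise.map s≤s (upTo≤toℕ-trues (f ∘ Fin.suc))))
... | false = subst₂ (Pointwise _≤_) (Listₚ.map-id (upTo (count (f ∘ Fin.suc)))) (map-toℕ-suc (trues (f ∘ Fin.suc)))
                (Pointwise.map⁺ (λ x → x) suc (Pointwise.map ℕₚ.m≤n⇒m≤1+n (upTo≤toℕ-trues (f ∘ Fin.suc))))

topJustified-≤ : ∀ {M} (f : Fin M → Bool) → SetLeq (trues {M} (topJustified (count f))) (trues f)
topJustified-≤ {M} f = Pointwise.map⁻ toℕ toℕ
  (subst (λ z → Pointwise _≤_ z (map toℕ (trues f))) (sym (toℕ-trues-topJustified M (count≤ f))) (upTo≤toℕ-trues f))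

Weights : ∀ {N m} → Diagram N m → Point N → Set
Weights {N} {m} D x = ∃[ C ] (DiagLeq {N} {m} C D × toPoint (wt C) ≡ x)

occupied : ∀ {N m} → Diagram N m → Fin m → Bool
occupied D j = 0 <ᵇ length (column D j)

occupiedColumns : ∀ {N m} → Diagram N m → ℕ
occupiedColumns D = count (occupied D)

module Gluing (n k : ℕ) where

  open Blocks n k
  open ShiftedHull n k using (shiftedJoin; lookup-shiftedJoin-L; lookup-shiftedJoin-R; ShiftedProduct)

  allFin-blocks : allFin (n + k) ≡ map L (allFin k) ++ map R (allFin n)
  allFin-blocks = begin
    allFin (n + k)                                           ≡⟨ tabulate-cast (ℕₚ.+-comm k n) (λ i → i) ⟩
    List.tabulate (cast (ℕₚ.+-comm k n))                     ≡⟨ tabulate-++ k (cast (ℕₚ.+-comm k n)) ⟩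
    List.tabulate L ++ List.tabulate R                       ≡⟨ cong₂ _++_ (Listₚ.map-tabulate (λ i → i) L) (Listₚ.map-tabulate (λ i → i) R) ⟨
    map L (allFin k) ++ map R (allFin n)                     ∎
    where open ≡-Reasoning

  trues-blocks : ∀ (g : Fin (n + k) → Bool) → trues g ≡ map L (trues (g ∘ L)) ++ map R (trues (g ∘ R))
  trues-blocks g = begin
    trues g                                                        ≡⟨ cong (filter g?) allFin-blocks ⟩
    filter g? (map L (allFin k) ++ map R (allFin n))               ≡⟨ Listₚ.filter-++ g? (map L (allFin k)) (map R (allFin n)) ⟩
    filter g? (map L (allFin k)) ++ filter g? (map R (allFin n))   ≡⟨ cong₂ _++_ (filter-map g? L (allFin k)) (filter-map g? R (allFin n)) ⟩
    map L (trues (g ∘ L)) ++ map R (trues (g ∘ R))                 ∎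
    where
    open ≡-Reasoning
    g? = λ i → g i Bool.≟ true

  SetLeq-refl : ∀ {M} (xs : List (Fin M)) → SetLeq xs xs
  SetLeq-refl xs = Pointwise.refl ℕₚ.≤-refl

  SetLeq-map-L : ∀ {xs ys} → SetLeq xs ys → SetLeq (map L xs) (map L ys)
  SetLeq-map-L le = Pointwise.map⁺ L L (Pointwise.map (λ {a} {b} → subst₂ _≤_ (sym (toℕ-L a)) (sym (toℕ-L b))) le)

  SetLeq-map-R : ∀ {xs ys} → SetLeq xs ys → SetLeq (map R xs) (map R ys)
  SetLeq-map-R le = Pointwise.map⁺ R R (Pointwise.map (λ {a} {b} → subst₂ _≤_ (sym (toℕ-R a)) (sym (toℕ-R b)) ∘ ℕₚ.+-monoʳ-≤ k) le)

  SetLeq-map-R⁻ : ∀ {xs ys} → SetLeq (map R xs) (map R ys) → SetLeq xs ys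
  SetLeq-map-R⁻ le = Pointwise.map (λ {a} {b} → ℕₚ.+-cancelˡ-≤ k _ _ ∘ subst₂ _≤_ (toℕ-R a) (toℕ-R b)) (Pointwise.map⁻ R R le)

  R≰L : ∀ b a → ¬ (toℕ (R b) ≤ toℕ (L a))
  R≰L b a le = ℕₚ.<⇒≱ (Finₚ.toℕ<n a) (ℕₚ.≤-trans (ℕₚ.m≤m+n k (toℕ b)) (subst₂ _≤_ (toℕ-R b) (toℕ-L a) le))

  SetLeq-into-L : ∀ X Y Z → SetLeq (map L X ++ map R Y) (map L Z) → Y ≡ [] × SetLeq X Z
  SetLeq-into-L []      []      []      []       = refl , []
  SetLeq-into-L []      (y ∷ Y) (z ∷ Z) (le ∷ _) = ⊥-elim (R≰L y z le)
  SetLeq-into-L (x ∷ X) Y       (z ∷ Z) (le ∷ les) with SetLeq-into-L X Y Z les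
  ... | Y≡[] , X≤Z = Y≡[] , subst₂ _≤_ (toℕ-L x) (toℕ-L z) le ∷ X≤Z

  SetLeq-blocks-length : ∀ X Y Z W → SetLeq (map L X ++ map R Y) (map L Z ++ map R W) → length Z ≤ length X
  SetLeq-blocks-length X       Y       []      W _          = z≤n
  SetLeq-blocks-length []      (y ∷ Y) (z ∷ Z) W (le ∷ _)   = ⊥-elim (R≰L y z le)
  SetLeq-blocks-length (x ∷ X) Y       (z ∷ Z) W (_ ∷ les)  = s≤s (SetLeq-blocks-length X Y Z W les)

  SetLeq-++⁻ : ∀ {M} (xs ys xs′ ys′ : List (Fin M)) → length xs ≡ length xs′ →
               SetLeq (xs ++ ys) (xs′ ++ ys′) → SetLeq xs xs′ × SetLeq ys ys′
  SetLeq-++⁻ []       ys []         ys′ _  le         = [] , le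
  SetLeq-++⁻ (x ∷ xs) ys (x′ ∷ xs′) ys′ eq (le ∷ les) with SetLeq-++⁻ xs ys xs′ ys′ (ℕₚ.suc-injective eq) les
  ... | xs≤ , ys≤ = le ∷ xs≤ , ys≤

  module _ {m : ℕ} (D : Diagram n m) where

    padding : Fin n → Bool
    padding p = toℕ p <ᵇ (n ∸ occupiedColumns D)

    module _ {m′ : ℕ} where

      left : Fin m′ → Fin (m′ + (m + n))
      left j = j ↑ˡ (m + n)

      right : Fin m → Fin (m′ + (m + n))
      right j = m′ ↑ʳ (j ↑ˡ n)

      extra : Fin n → Fin (m′ + (m + n))
      extra p = m′ ↑ʳ (m ↑ʳ p)

      data ColumnView : Fin (m′ + (m + n)) → Set where
        inLeft  : ∀ j → ColumnView (left j)
        inRight : ∀ j → ColumnView (right j)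
        inExtra : ∀ p → ColumnView (extra p)

      columnView : ∀ J → ColumnView J
      columnView J with splitAt m′ J in eq₁
      ... | inj₁ j = subst ColumnView (Finₚ.splitAt⁻¹-↑ˡ eq₁) (inLeft j)
      ... | inj₂ J′ with splitAt m J′ in eq₂
      ...   | inj₁ j = subst ColumnView (trans (cong (m′ ↑ʳ_) (Finₚ.splitAt⁻¹-↑ˡ eq₂)) (Finₚ.splitAt⁻¹-↑ʳ eq₁)) (inRight j)
      ...   | inj₂ p = subst ColumnView (trans (cong (m′ ↑ʳ_) (Finₚ.splitAt⁻¹-↑ʳ eq₂)) (Finₚ.splitAt⁻¹-↑ʳ eq₁)) (inExtra p)

      glueEntry : Diagram k m′ → Diagram n m → Fin k ⊎ Fin n → Fin m′ ⊎ Fin (m + n) → Bool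
      glueEntry X′ X (inj₁ a) (inj₁ j) = X′ a j
      glueEntry X′ X (inj₂ b) (inj₁ j) = false
      glueEntry X′ X (inj₁ a) (inj₂ J) = [ occupied D , padding ]′ (splitAt m J)
      glueEntry X′ X (inj₂ b) (inj₂ J) = [ X b , (λ _ → false) ]′ (splitAt m J)

      -- X′ in the top rows of the left columns; X in the bottom rows of the middle columns, whose top rows
      -- are full when the column of D is nonempty; full top rows in the first n ∸ occupiedColumns D extra columns.
      glue : Diagram k m′ → Diagram n m → Diagram (n + k) (m′ + (m + n))
      glue X′ X i J = glueEntry X′ X (block i) (splitAt m′ J)

      module _ (X′ : Diagram k m′) (X : Diagram n m) where

        glue-L-left : ∀ a j → glue X′ X (L a) (left j) ≡ X′ a j
        glue-L-left a j rewrite block-L a | Finₚ.splitAt-↑ˡ m′ j (m + n) = refl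

        glue-R-left : ∀ b j → glue X′ X (R b) (left j) ≡ false
        glue-R-left b j rewrite block-R b | Finₚ.splitAt-↑ˡ m′ j (m + n) = refl

        glue-L-right : ∀ a j → glue X′ X (L a) (right j) ≡ occupied D j
        glue-L-right a j rewrite block-L a | Finₚ.splitAt-↑ʳ m′ (m + n) (j ↑ˡ n) | Finₚ.splitAt-↑ˡ m j n = refl

        glue-R-right : ∀ b j → glue X′ X (R b) (right j) ≡ X b j
        glue-R-right b j rewrite block-R b | Finₚ.splitAt-↑ʳ m′ (m + n) (j ↑ˡ n) | Finₚ.splitAt-↑ˡ m j n = refl

        glue-L-extra : ∀ a p → glue X′ X (L a) (extra p) ≡ padding p
        glue-L-extra a p rewrite block-L a | Finₚ.splitAt-↑ʳ m′ (m + n) (m ↑ʳ p) | Finₚ.splitAt-↑ʳ m n p = refl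

        glue-R-extra : ∀ b p → glue X′ X (R b) (extra p) ≡ false
        glue-R-extra b p rewrite block-R b | Finₚ.splitAt-↑ʳ m′ (m + n) (m ↑ʳ p) | Finₚ.splitAt-↑ʳ m n p = refl

        column-left : ∀ j → column (glue X′ X) (left j) ≡ map L (column X′ j) ++ map R []
        column-left j = trans (trues-blocks _)
          (cong₂ (λ u v → map L u ++ map R v) (trues-cong (λ a → glue-L-left a j)) (trues-false (λ b → glue-R-left b j)))

        column-right : ∀ j → column (glue X′ X) (right j) ≡ map L (trues {k} (λ _ → occupied D j)) ++ map R (column X j)
        column-right j = trans (trues-blocks _)
          (cong₂ (λ u v → map L u ++ map R v) (trues-cong (λ a → glue-L-right a j)) (trues-cong (λ b → glue-R-right b j)))

        column-extra : ∀ p → column (glue X′ X) (extra p) ≡ map L (trues {k} (λ _ → padding p)) ++ map R []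
        column-extra p = trans (trues-blocks _)
          (cong₂ (λ u v → map L u ++ map R v) (trues-cong (λ a → glue-L-extra a p)) (trues-false (λ b → glue-R-extra b p)))

      glue-mono : ∀ {C′ D′ : Diagram k m′} {C : Diagram n m} → DiagLeq C′ D′ → DiagLeq C D → DiagLeq (glue C′ C) (glue D′ D)
      glue-mono {C′} {D′} {C} C′≤D′ C≤D J with columnView J
      ... | inLeft j  = subst₂ SetLeq (sym (column-left C′ C j)) (sym (column-left D′ D j)) (Pointwise.++⁺ (SetLeq-map-L (C′≤D′ j)) [])
      ... | inRight j = subst₂ SetLeq (sym (column-right C′ C j)) (sym (column-right D′ D j)) (Pointwise.++⁺ (SetLeq-refl _) (SetLeq-map-R (C≤D j)))
      ... | inExtra p = subst₂ SetLeq (sym (column-extra C′ C p)) (sym (column-extra D′ D p)) (SetLeq-refl _)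

      module Decompose {D′ : Diagram k m′} (C″ : Diagram (n + k) (m′ + (m + n))) (C″≤ : DiagLeq C″ (glue D′ D)) where

        C′ : Diagram k m′
        C′ a j = C″ (L a) (left j)

        C° : Diagram n m
        C° b j = C″ (R b) (right j)

        private
          top bottom : Fin (m′ + (m + n)) → List _
          top    J = trues (λ a → C″ (L a) J)
          bottom J = trues (λ b → C″ (R b) J)

          C″≤-at : ∀ J {Z} → column (glue D′ D) J ≡ Z → SetLeq (map L (top J) ++ map R (bottom J)) Z
          C″≤-at J eq = subst₂ SetLeq (trues-blocks (λ i → C″ i J)) eq (C″≤ J)

          below-full : ∀ J {W} → SetLeq (map L (top J) ++ map R (bottom J)) (map L (allFin k) ++ map R W) →
                       (∀ a → C″ (L a) J ≡ true) × SetLeq (bottom J) W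
          below-full J {W} le = length-trues≡⇒true _ top≡k , SetLeq-map-R⁻ (proj₂ (SetLeq-++⁻ _ _ _ _ lengths le))
            where
            top≡k : length (top J) ≡ k
            top≡k = ℕₚ.≤-antisym (subst (length (top J) ≤_) (Listₚ.length-tabulate (λ i → i)) (Listₚ.length-filter _ (allFin k)))
                      (subst (_≤ length (top J)) (Listₚ.length-tabulate (λ i → i)) (SetLeq-blocks-length _ (bottom J) (allFin k) W le))
            lengths : length (map L (top J)) ≡ length (map L (allFin k))
            lengths = trans (Listₚ.length-map L (top J)) (trans top≡k (sym (trans (Listₚ.length-map L (allFin k)) (Listₚ.length-tabulate (λ i → i)))))

          below-empty : ∀ J → SetLeq (map L (top J) ++ map R (bottom J)) [] →
                        (∀ a → C″ (L a) J ≡ false) × (∀ b → C″ (R b) J ≡ false)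
          below-empty J le with top J in eq₁ | bottom J in eq₂ | le
          ... | [] | [] | [] = trues≡[]⇒false _ eq₁ , trues≡[]⇒false _ eq₂

          column≡[] : ∀ j → occupied D j ≡ false → column D j ≡ []
          column≡[] j eq with column D j
          ... | []    = refl
          ... | _ ∷ _ = case eq of λ ()

          at-left : ∀ j → (∀ b → C″ (R b) (left j) ≡ false) × SetLeq (column C′ j) (column D′ j)
          at-left j with SetLeq-into-L (top (left j)) (bottom (left j)) (column D′ j)
                           (C″≤-at (left j) (trans (column-left D′ D j) (Listₚ.++-identityʳ _)))
          ... | bottom≡[] , le = trues≡[]⇒false _ bottom≡[] , le

          at-right : ∀ j → (∀ a → C″ (L a) (right j) ≡ occupied D j) × SetLeq (column C° j) (column D j)
          at-right j with occupied D j in occ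
          ... | true  = below-full (right j) (C″≤-at (right j) (trans (column-right D′ D j)
                          (cong (λ z → map L z ++ map R (column D j)) (trues-true (λ _ → occ)))))
          ... | false with below-empty (right j) (C″≤-at (right j) (trans (column-right D′ D j)
                             (cong₂ (λ u v → map L u ++ map R v) (trues-false (λ _ → occ)) (column≡[] j occ))))
          ...   | top-false , bottom-false = top-false
                                           , subst₂ SetLeq (sym (trues-false bottom-false)) (sym (column≡[] j occ)) []

          at-extra : ∀ p → (∀ a → C″ (L a) (extra p) ≡ padding p) × (∀ b → C″ (R b) (extra p) ≡ false)
          at-extra p with padding p in pad
          ... | true with below-full (extra p) (C″≤-at (extra p) (trans (column-extra D′ D p)
                            (cong (λ z → map L z ++ map R []) (trues-true (λ _ → pad)))))
          ...   | top-true , bottom≤[] with bottom (extra p) in eq | bottom≤[]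
          ...     | [] | [] = top-true , trues≡[]⇒false _ eq
          at-extra p | false = below-empty (extra p) (C″≤-at (extra p) (trans (column-extra D′ D p)
                                 (cong (λ z → map L z ++ map R []) (trues-false (λ _ → pad)))))

        C′≤D′ : DiagLeq C′ D′
        C′≤D′ j = proj₂ (at-left j)

        C°≤D : DiagLeq C° D
        C°≤D j = proj₂ (at-right j)

        C″≗glue : ∀ i J → C″ i J ≡ glue C′ C° i J
        C″≗glue i J with blockView i | columnView J
        ... | inL a | inLeft j  = sym (glue-L-left C′ C° a j)
        ... | inR b | inLeft j  = trans (proj₁ (at-left j) b) (sym (glue-R-left C′ C° b j))
        ... | inL a | inRight j = trans (proj₁ (at-right j) a) (sym (glue-L-right C′ C° a j))
        ... | inR b | inRight j = sym (glue-R-right C′ C° b j)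
        ... | inL a | inExtra p = trans (proj₁ (at-extra p) a) (sym (glue-L-extra C′ C° a p))
        ... | inR b | inExtra p = trans (proj₂ (at-extra p) b) (sym (glue-R-extra C′ C° b p))

      -- Since ∸ truncates, only with occupiedColumns D ≤ n does every top row get exactly n squares outside
      -- the left columns.
      module _ (r≤n : occupiedColumns D ≤ n) (X′ : Diagram k m′) (X : Diagram n m) where

        lookup-wt-glue-L : ∀ a → lookup (wt (glue X′ X)) (L a) ≡ n + lookup (wt X′) a
        lookup-wt-glue-L a = begin
          lookup (wt (glue X′ X)) (L a)
            ≡⟨ trans (lookup-wt (glue X′ X) (L a)) (count-++ m′ _) ⟩
          count (glue X′ X (L a) ∘ left) + count (λ J → glue X′ X (L a) (m′ ↑ʳ J))
            ≡⟨ cong₂ _+_ (count-cong (glue-L-left X′ X a)) (count-++ m _) ⟩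
          count (X′ a) + (count (glue X′ X (L a) ∘ right) + count (glue X′ X (L a) ∘ extra))
            ≡⟨ cong (_+_ (count (X′ a))) (cong₂ _+_ (count-cong (glue-L-right X′ X a)) (count-cong (glue-L-extra X′ X a))) ⟩
          count (X′ a) + (occupiedColumns D + count padding)
            ≡⟨ cong (λ z → count (X′ a) + (occupiedColumns D + z)) (count-<ᵇ n (ℕₚ.m∸n≤m n (occupiedColumns D))) ⟩
          count (X′ a) + (occupiedColumns D + (n ∸ occupiedColumns D))
            ≡⟨ cong (_+_ (count (X′ a))) (ℕₚ.m+[n∸m]≡n r≤n) ⟩
          count (X′ a) + n
            ≡⟨ trans (ℕₚ.+-comm _ n) (cong (_+_ n) (sym (lookup-wt X′ a))) ⟩
          n + lookup (wt X′) a ∎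
          where open ≡-Reasoning

        lookup-wt-glue-R : ∀ b → lookup (wt (glue X′ X)) (R b) ≡ lookup (wt X) b
        lookup-wt-glue-R b = begin
          lookup (wt (glue X′ X)) (R b)
            ≡⟨ trans (lookup-wt (glue X′ X) (R b)) (count-++ m′ _) ⟩
          count (glue X′ X (R b) ∘ left) + count (λ J → glue X′ X (R b) (m′ ↑ʳ J))
            ≡⟨ cong₂ _+_ (count-false (glue-R-left X′ X b)) (count-++ m _) ⟩
          count (glue X′ X (R b) ∘ right) + count (glue X′ X (R b) ∘ extra)
            ≡⟨ cong₂ _+_ (count-cong (glue-R-right X′ X b)) (count-false (glue-R-extra X′ X b)) ⟩
          count (X b) + 0
            ≡⟨ trans (ℕₚ.+-identityʳ _) (sym (lookup-wt X b)) ⟩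
          lookup (wt X) b ∎
          where open ≡-Reasoning

        toPoint-wt-glue : toPoint (wt (glue X′ X)) ≡ shiftedJoin (toPoint (wt X′)) (toPoint (wt X))
        toPoint-wt-glue = ≡-byBlocks onL onR
          where
          onL : ∀ a → lookup (toPoint (wt (glue X′ X))) (L a) ≡ lookup (shiftedJoin (toPoint (wt X′)) (toPoint (wt X))) (L a)
          onL a = begin
            lookup (toPoint (wt (glue X′ X))) (L a)      ≡⟨ lookup-toPoint (wt (glue X′ X)) (L a) ⟩
            ℕtoℚ (lookup (wt (glue X′ X)) (L a))         ≡⟨ cong ℕtoℚ (lookup-wt-glue-L a) ⟩
            ℕtoℚ (n + lookup (wt X′) a)                  ≡⟨ ℕtoℚ-+ n _ ⟩
            ℕtoℚ n ℚ.+ ℕtoℚ (lookup (wt X′) a)           ≡⟨ cong (ℚ._+_ (ℕtoℚ n)) (lookup-toPoint (wt X′) a) ⟨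
            ℕtoℚ n ℚ.+ lookup (toPoint (wt X′)) a        ≡⟨ lookup-shiftedJoin-L (toPoint (wt X′)) (toPoint (wt X)) a ⟨
            lookup (shiftedJoin (toPoint (wt X′)) (toPoint (wt X))) (L a) ∎
            where open ≡-Reasoning
          onR : ∀ b → lookup (toPoint (wt (glue X′ X))) (R b) ≡ lookup (shiftedJoin (toPoint (wt X′)) (toPoint (wt X))) (R b)
          onR b = begin
            lookup (toPoint (wt (glue X′ X))) (R b)      ≡⟨ lookup-toPoint (wt (glue X′ X)) (R b) ⟩
            ℕtoℚ (lookup (wt (glue X′ X)) (R b))         ≡⟨ cong ℕtoℚ (lookup-wt-glue-R b) ⟩
            ℕtoℚ (lookup (wt X) b)                       ≡⟨ lookup-toPoint (wt X) b ⟨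
            lookup (toPoint (wt X)) b                    ≡⟨ lookup-shiftedJoin-R (toPoint (wt X′)) (toPoint (wt X)) b ⟨
            lookup (shiftedJoin (toPoint (wt X′)) (toPoint (wt X))) (R b) ∎
            where open ≡-Reasoning

      Weights-glue : ∀ {D′ : Diagram k m′} → occupiedColumns D ≤ n →
                     SamePolytope (Weights (glue D′ D)) (ShiftedProduct (Weights D′) (Weights D))
      Weights-glue r≤n x = to , from
        where
        to : Weights (glue _ D) x → ShiftedProduct (Weights _) (Weights D) x
        to (C″ , C″≤ , refl) = toPoint (wt C′) , toPoint (wt C°) , (C′ , C′≤D′ , refl) , (C° , C°≤D , refl) ,
                               trans (cong toPoint (wt-cong C″≗glue)) (toPoint-wt-glue r≤n C′ C°)
          where open Decompose C″ C″≤
        from : ShiftedProduct (Weights _) (Weights D) x → Weights (glue _ D) x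
        from (_ , _ , (C′ , C′≤ , refl) , (C , C≤ , refl) , refl) = glue C′ C , glue-mono C′≤ C≤ , toPoint-wt-glue r≤n C′ C

  glued : ∀ {m′ m} → Diagram k m′ → Diagram n m → Diagram (n + k) (m′ + (m + n))
  glued D′ D = glue D D′ D


topJustifiedDiagram : ∀ {N m} → Diagram N m → Diagram N m
topJustifiedDiagram D i j = topJustified (length (column D j)) i

topJustifiedDiagram-≤ : ∀ {N m} (D : Diagram N m) → DiagLeq (topJustifiedDiagram D) D
topJustifiedDiagram-≤ D j = subst (λ ℓ → SetLeq (trues (topJustified ℓ)) (column D j)) (sym (length-trues (λ i → D i j)))
                                  (topJustified-≤ (λ i → D i j))

support-topComponent-bounded : ∀ {N} (u : Fin N → Fin N) i →
  ∀ y → Support (topComponent (groth u)) y → lookup y i ℚ.≤ ℕtoℚ (N ∸ 1)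
support-topComponent-bounded {N} u i _ (e , nz , refl) = subst (ℚ._≤ ℕtoℚ (N ∸ 1)) (sym (lookup-toPoint e i))
  (ℕtoℚ-mono-≤ (topComponent-bounded (groth u) (grothFuel-bounded (N * N) u) nz i))

-- The top-justified diagram of D lies below D and has one square in its first row per nonempty
-- column of D; its weight lies in the Newton polytope, whose coordinates are at most N ∸ 1.
occupiedColumns≤ : ∀ {N m} (D : Diagram N m) (u : Fin N → Fin N) →
                   SamePolytope (NewtonTopGroth u) (Schubitope D) → occupiedColumns D ≤ N
occupiedColumns≤ {zero}  D u _    = ℕₚ.≤-reflexive (count-false {f = occupied D} (λ _ → refl))
occupiedColumns≤ {suc N} D u same = ℕₚ.m≤n⇒m≤1+n (ℕtoℚ-cancel-≤ (begin
  ℕtoℚ (occupiedColumns D)                       ≡⟨ cong ℕtoℚ (lookup-wt (topJustifiedDiagram D) Fin.zero) ⟨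
  ℕtoℚ (lookup (wt (topJustifiedDiagram D)) Fin.zero)  ≡⟨ lookup-toPoint (wt (topJustifiedDiagram D)) Fin.zero ⟨
  lookup p Fin.zero                              ≤⟨ ConvHull-lookup-≤ _ Fin.zero _ (support-topComponent-bounded u Fin.zero) p p∈Newton ⟩
  ℕtoℚ N                                         ∎))
  where
  open ℚₚ.≤-Reasoning
  p = toPoint (wt (topJustifiedDiagram D))
  p∈Newton : NewtonTopGroth u p
  p∈Newton = proj₂ (same p) (ConvHull-singleton _ p (topJustifiedDiagram D , topJustifiedDiagram-≤ D , refl))

module TopSupport (n k : ℕ) where

  open Blocks n k
  open Product n k
  open ProductSupport n k
  open ShiftedHull n k

  toPoint-join-shift : ∀ e₁ e₂ → toPoint (join (shift e₁) e₂) ≡ shiftedJoin (toPoint e₁) (toPoint e₂)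
  toPoint-join-shift e₁ e₂ = ≡-byBlocks onL onR
    where
    onL : ∀ a → lookup (toPoint (join (shift e₁) e₂)) (L a) ≡ lookup (shiftedJoin (toPoint e₁) (toPoint e₂)) (L a)
    onL a = begin
      lookup (toPoint (join (shift e₁) e₂)) (L a)     ≡⟨ lookup-toPoint (join (shift e₁) e₂) (L a) ⟩
      ℕtoℚ (lookup (join (shift e₁) e₂) (L a))        ≡⟨ cong ℕtoℚ (trans (lookup-join-L (shift e₁) e₂ a) (lookup-shift e₁ a)) ⟩
      ℕtoℚ (n + lookup e₁ a)                          ≡⟨ ℕtoℚ-+ n _ ⟩
      ℕtoℚ n ℚ.+ ℕtoℚ (lookup e₁ a)                   ≡⟨ cong (ℚ._+_ (ℕtoℚ n)) (lookup-toPoint e₁ a) ⟨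
      ℕtoℚ n ℚ.+ lookup (toPoint e₁) a                ≡⟨ lookup-shiftedJoin-L (toPoint e₁) (toPoint e₂) a ⟨
      lookup (shiftedJoin (toPoint e₁) (toPoint e₂)) (L a) ∎
      where open ≡-Reasoning
    onR : ∀ b → lookup (toPoint (join (shift e₁) e₂)) (R b) ≡ lookup (shiftedJoin (toPoint e₁) (toPoint e₂)) (R b)
    onR b = begin
      lookup (toPoint (join (shift e₁) e₂)) (R b)     ≡⟨ lookup-toPoint (join (shift e₁) e₂) (R b) ⟩
      ℕtoℚ (lookup (join (shift e₁) e₂) (R b))        ≡⟨ cong ℕtoℚ (lookup-join-R (shift e₁) e₂ b) ⟩
      ℕtoℚ (lookup e₂ b)                              ≡⟨ lookup-toPoint e₂ b ⟨
      lookup (toPoint e₂) b                           ≡⟨ lookup-shiftedJoin-R (toPoint e₁) (toPoint e₂) b ⟨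
      lookup (shiftedJoin (toPoint e₁) (toPoint e₂)) (R b) ∎
      where open ≡-Reasoning

  Support-topComponent-shiftedProduct : ∀ {P A B} → P ↭ shiftedProduct A B →
    SamePolytope (Support (topComponent P)) (ShiftedProduct (Support (topComponent A)) (Support (topComponent B)))
  Support-topComponent-shiftedProduct {P} {A} {B} P↭AB x = to , from
    where
    to : Support (topComponent P) x → ShiftedProduct (Support (topComponent A)) (Support (topComponent B)) x
    to (e , nz , refl) with TopMonomial-shiftedProduct⁻ A B (TopMonomial-↭ P↭AB (topComponent⇒TopMonomial P nz))
    ... | e₁ , e₂ , refl , top₁ , top₂ =
      toPoint e₁ , toPoint e₂ , (e₁ , TopMonomial⇒topComponent A top₁ , refl) , (e₂ , TopMonomial⇒topComponent B top₂ , refl) ,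
      toPoint-join-shift e₁ e₂
    from : ShiftedProduct (Support (topComponent A)) (Support (topComponent B)) x → Support (topComponent P) x
    from (_ , _ , (e₁ , nz₁ , refl) , (e₂ , nz₂ , refl) , refl) =
      join (shift e₁) e₂ ,
      TopMonomial⇒topComponent P (TopMonomial-↭ (↭-sym P↭AB)
        (TopMonomial-shiftedProduct⁺ A B (topComponent⇒TopMonomial A nz₁) (topComponent⇒TopMonomial B nz₂))) ,
      toPoint-join-shift e₁ e₂


corollary5p9 : (n k : ℕ) (w : Permutation′ n) (w' : Permutation′ k) →
    IsSchubitope (NewtonTopGroth (w ⟨$⟩ʳ_)) →
    IsSchubitope (NewtonTopGroth (w' ⟨$⟩ʳ_)) →
    IsSchubitope (NewtonTopGroth {n + k} (concatPerm w w'))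
corollary5p9 n k w w′ (m , D , sameD) (m′ , D′ , sameD′) =
  m′ + (m + n) , glued D′ D ,
  ConvHull-ShiftedProduct-cong
    (Support-topComponent-shiftedProduct {A = groth (w′ ⟨$⟩ʳ_)} {B = groth (w ⟨$⟩ʳ_)} (groth-concatPerm w w′))
    (Weights-glue D (occupiedColumns≤ D (w ⟨$⟩ʳ_) sameD))
    sameD′ sameD
  where
  open Concatenation n k
  open TopSupport n k
  open ShiftedHull n k
  open Gluing n k
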